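{- For the generalized patterns $123,132,213,231,312,321$ (all without dashes): (1) $F_{123}(x)=F_{321}(x)=\dfrac{1-x-\sqrt{1-2x-3x^2}}{2x^2}$; (2) $F_{132}(x)=\dfrac{1-\sqrt{1-4x}}{2x}$; (3) $F_{213}(x)=F_{312}(x)=\dfrac{1-x^2-\sqrt{(1+x^2)^2-4x}}{2x(1-x)}$; (4) $F_{231}(x)=\dfrac{1-x}{1-2x}$.
   Context: A generalized pattern is a permutation of $\{1,\dots,k\}$ written as a word $\tau_1\cdots\tau_k$ in which each pair of adjacent letters may or may not be separated by a dash "-". A permutation $\pi=\pi_1\cdots\pi_n\in S_n$ contains $\tau$ if there are indices $i_1<\dots<i_k$ with $(\pi_{i_1},\dots,\pi_{i_k})$ order-isomorphic to $(\tau_1,\dots,\tau_k)$ and $i_{j+1}=i_j+1$ whenever $\tau_j,\tau_{j+1}$ are not separated by a dash; otherwise $\pi$ avoids $\tau$. So a pattern with no dashes requires consecutive entries, and $1\mbox{ - }3\mbox{ - }2$ is the classical pattern $132$. $F_\tau(x)=\sum_{n\geq0}f_\tau(n)x^n$, where $f_\tau(n)$ is the number of permutations in $S_n$ ($S_0$ = the empty permutation) avoiding both $1\mbox{ - }3\mbox{ - }2$ and $\tau$. -}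

module Defs where

open import Data.Bool using (Bool; true; false; _∧_; _∨_; not; T; T?)
open import Data.Nat as ℕ using (ℕ; zero; suc; _≡ᵇ_; _<ᵇ_)
open import Data.Integer as ℤ using (ℤ; +_)
open import Data.List using (List; []; _∷_; map; concatMap; length; filter; zip; cartesianProduct; upTo; foldr)
open import Data.Product using (_×_; _,_; proj₁; proj₂)
open import Data.Bool.ListAction using (any; all)

-- Permutations of {1,…,n} as lists (one-line notation π₁ ⋯ πₙ)

insertAll : ℕ → List ℕ → List (List ℕ)
insertAll x []       = (x ∷ []) ∷ []
insertAll x (y ∷ ys) = (x ∷ y ∷ ys) ∷ map (y ∷_) (insertAll x ys)

perms : ℕ → List (List ℕ)
perms zero    = [] ∷ []
perms (suc n) = concatMap (insertAll (suc n)) (perms n)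

-- word = τ₁ ⋯ τ_k ; tight has k-1 entries, the j-th is true iff
-- τ_j and τ_{j+1} are NOT separated by a dash (must be adjacent in π).
record GPattern : Set where
  constructor gpat
  field
    word  : List ℕ
    tight : List Bool
open GPattern public

choose : ℕ → List ℕ → List (List ℕ)
choose zero    _        = [] ∷ []
choose (suc k) []       = []
choose (suc k) (i ∷ is) = map (i ∷_) (choose k is) ++' choose (suc k) is
  where
  _++'_ : List (List ℕ) → List (List ℕ) → List (List ℕ)
  xs ++' ys = foldr _∷_ ys xs

-- entry at 0-based position i (default 0, never used out of range)
at : List ℕ → ℕ → ℕ
at []       _       = 0
at (x ∷ xs) zero    = x
at (x ∷ xs) (suc i) = at xs i

adjOK : List Bool → List ℕ → Bool
adjOK (b ∷ bs) (i ∷ j ∷ is) = (not b ∨ (j ≡ᵇ suc i)) ∧ adjOK bs (j ∷ is)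
adjOK _        _            = true

_==ᵇ_ : Bool → Bool → Bool
true  ==ᵇ b = b
false ==ᵇ b = not b

orderIso : List ℕ → List ℕ → Bool
orderIso xs ys =
  (length xs ≡ᵇ length ys) ∧
  all (λ pq → ((proj₁ (proj₁ pq) <ᵇ proj₁ (proj₂ pq)) ==ᵇ
               (proj₂ (proj₁ pq) <ᵇ proj₂ (proj₂ pq))))
      (cartesianProduct (zip xs ys) (zip xs ys))

contains : GPattern → List ℕ → Bool
contains τ π =
  any (λ is → adjOK (tight τ) is ∧ orderIso (map (at π) is) (word τ))
      (choose (length (word τ)) (upTo (length π)))

avoids : GPattern → List ℕ → Bool
avoids τ π = not (contains τ π)

p1-3-2 : GPattern
p1-3-2 = gpat (1 ∷ 3 ∷ 2 ∷ []) (false ∷ false ∷ [])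

dashless : ℕ → ℕ → ℕ → GPattern
dashless a b c = gpat (a ∷ b ∷ c ∷ []) (true ∷ true ∷ [])

f : GPattern → ℕ → ℕ
f τ n = length (filter (λ π → T? (avoids p1-3-2 π ∧ avoids τ π)) (perms n))

-- Formal power series over ℤ (coefficient sequences)

PS : Set
PS = ℕ → ℤ

F : GPattern → PS
F τ n = + (f τ n)

poly : List ℤ → PS
poly []       _       = + 0
poly (c ∷ cs) zero    = c
poly (c ∷ cs) (suc n) = poly cs n

_⊛_ : PS → PS → PS
(A ⊛ B) n = foldr ℤ._+_ (+ 0) (map (λ i → A i ℤ.* B (n ℕ.∸ i)) (upTo (suc n)))

_⊕_ : PS → PS → PS
(A ⊕ B) n = A n ℤ.+ B n

_⊖_ : PS → PS → PS
(A ⊖ B) n = A n ℤ.- B n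

infixl 7 _⊛_
infixl 6 _⊕_ _⊖_

-- A 132-avoiding permutation of length n + 1 is uniquely α′ (n + 1) β, where β avoids 132 and α′ is a
-- 132-avoider shifted above every entry of β; conversely every such gluing avoids 132. A window abc of three
-- adjacent entries of the glued permutation lies inside α′ or β, or is one of the three windows through n + 1,
-- which only see the last two entries of α′ and the first two of β. Counting avoiders together with these boundary
-- conditions yields convolution recurrences, i.e. equations A·F = 1 + B·F² for the generating functions, and the
-- closed forms follow from (A − 2BF)² = A² − 4B. The boundary conditions for 123 and 321 (and for 213 and 312)
-- are mirror images, so their recurrences agree after exchanging the two factors of each convolution.

module Submission where

module NatConvolution where

  open import Data.Nat using (ℕ; zero; suc; _+_; _≤_; _<_; s≤s)
  open import Data.Nat.Properties
  open import Data.Nat.Induction using (<-rec)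
  open import Relation.Binary.PropositionalEquality

  csum : (ℕ → ℕ → ℕ) → ℕ → ℕ
  csum G zero    = G 0 0
  csum G (suc n) = G 0 (suc n) + csum (λ i j → G (suc i) j) n

  csum-cong : ∀ {G H} n → (∀ i j → i + j ≡ n → G i j ≡ H i j) → csum G n ≡ csum H n
  csum-cong zero    eq = eq 0 0 refl
  csum-cong (suc n) eq = cong₂ _+_ (eq 0 (suc n) refl) (csum-cong n λ i j e → eq (suc i) j (cong suc e))

  csum-sucʳ : ∀ G n → csum G (suc n) ≡ csum (λ i j → G i (suc j)) n + G (suc n) 0
  csum-sucʳ G zero    = refl
  csum-sucʳ G (suc n) =
    trans (cong (G 0 (suc (suc n)) +_) (csum-sucʳ (λ i j → G (suc i) j) n))
          (sym (+-assoc (G 0 (suc (suc n))) _ _))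

  csum-swap : ∀ G n → csum G n ≡ csum (λ i j → G j i) n
  csum-swap G zero    = refl
  csum-swap G (suc n) =
    trans (cong (G 0 (suc n) +_) (csum-swap (λ i j → G (suc i) j) n))
          (trans (+-comm (G 0 (suc n)) _) (sym (csum-sucʳ (λ i j → G j i) n)))

  csum-zero : ∀ n → csum (λ _ _ → 0) n ≡ 0
  csum-zero zero    = refl
  csum-zero (suc n) = csum-zero n

  csum-column₀ : ∀ G H m → (∀ i → G i 0 ≡ 0) → (∀ i j → G i (suc j) ≡ H i (suc j)) → csum G m + H m 0 ≡ csum H m
  csum-column₀ G H zero    G₀ G≡H = cong (_+ H 0 0) (G₀ 0)
  csum-column₀ G H (suc m) G₀ G≡H = begin
    csum G (suc m) + H (suc m) 0
      ≡⟨ cong (_+ H (suc m) 0) (csum-sucʳ G m) ⟩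
    csum (λ i j → G i (suc j)) m + G (suc m) 0 + H (suc m) 0
      ≡⟨ cong₂ (λ x y → x + y + H (suc m) 0) (csum-cong m λ i j _ → G≡H i j) (G₀ (suc m)) ⟩
    csum (λ i j → H i (suc j)) m + 0 + H (suc m) 0
      ≡⟨ cong (_+ H (suc m) 0) (+-identityʳ _) ⟩
    csum (λ i j → H i (suc j)) m + H (suc m) 0
      ≡⟨ csum-sucʳ H m ⟨
    csum H (suc m) ∎
    where open ≡-Reasoning

  Recurrence : ((ℕ → ℕ) → ℕ → ℕ) → (ℕ → ℕ) → Set
  Recurrence step a = ∀ n → a (suc n) ≡ step a n

  Causal : ((ℕ → ℕ) → ℕ → ℕ) → Set
  Causal step = ∀ {a b} n → (∀ k → k ≤ n → a k ≡ b k) → step a n ≡ step b n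

  recurrence-unique : ∀ {step a b} → Causal step → a 0 ≡ b 0 →
                      Recurrence step a → Recurrence step b → ∀ n → a n ≡ b n
  recurrence-unique {step} {a} {b} causal a₀≡b₀ rec-a rec-b = <-rec (λ n → a n ≡ b n) go
    where
    go : ∀ n → (∀ {k} → k < n → a k ≡ b k) → a n ≡ b n
    go zero    _  = a₀≡b₀
    go (suc n) ih = trans (rec-a n) (trans (causal n (λ k k≤n → ih (s≤s k≤n))) (sym (rec-b n)))

  csum-causal : ∀ (G : (ℕ → ℕ) → ℕ → ℕ → ℕ) → (∀ {a b i j} → a i ≡ b i → a j ≡ b j → G a i j ≡ G b i j) →
                Causal (λ a → csum (G a))
  csum-causal G G-cong n a≗b =
    csum-cong n λ i j i+j≡n → G-cong (a≗b i (≤-trans (m≤m+n i j) (≤-reflexive i+j≡n)))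
                                       (a≗b j (≤-trans (m≤n+m j i) (≤-reflexive i+j≡n)))

module PowerSeries where

  open import Defs using (PS; poly; _⊛_; _⊕_; _⊖_)
  open import Data.Nat as ℕ using (ℕ; zero; suc)
  open import Data.Integer as ℤ using (ℤ; +_; -_; _+_; _*_; _-_)
  import Data.Integer.Properties as ℤ
  open import Data.List using (List; []; _∷_; map; foldr; applyUpTo)
  open import Data.List.Properties using (map-upTo)
  open import Data.Product using (_,_; _×_; ∃-syntax)
  open import Data.Maybe using (Maybe; just; nothing)
  open import Relation.Nullary using (yes; no)
  open import Relation.Binary.PropositionalEquality
  open import Function using (_∘_; _⟨_⟩_)
  open import Level using (0ℓ)
  open import Algebra.Bundles using (CommutativeRing; Ring)
  open import Data.Integer.Tactic.RingSolver using (solve-∀)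
  open NatConvolution using (csum)

  tail : PS → PS
  tail A = A ∘ suc

  neg : PS → PS
  neg A n = - A n

  cst : ℤ → PS
  cst c = poly (c ∷ [])

  one : PS
  one = cst (+ 1)

  X : PS
  X = poly (+ 0 ∷ + 1 ∷ [])

  embed : (ℕ → ℕ) → PS
  embed a n = + a n

  conv : PS → PS → PS
  conv A B zero    = A 0 * B 0
  conv A B (suc n) = A 0 * B (suc n) + conv (tail A) B n

  ⊛≗conv : ∀ A B → A ⊛ B ≗ conv A B
  ⊛≗conv A B n = trans (cong (foldr _+_ (+ 0)) (map-upTo (λ i → A i * B (n ℕ.∸ i)) (suc n))) (sum≡conv A B n)
    where
    sum≡conv : ∀ A B n → foldr _+_ (+ 0) (applyUpTo (λ i → A i * B (n ℕ.∸ i)) (suc n)) ≡ conv A B n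
    sum≡conv A B zero    = ℤ.+-identityʳ _
    sum≡conv A B (suc n) = cong (_+_ (A 0 * B (suc n))) (sum≡conv (tail A) B n)

  conv-cong : ∀ {A A′ B B′} → A ≗ A′ → B ≗ B′ → conv A B ≗ conv A′ B′
  conv-cong a b zero    = cong₂ _*_ (a 0) (b 0)
  conv-cong a b (suc n) = cong₂ _+_ (cong₂ _*_ (a 0) (b (suc n))) (conv-cong (a ∘ suc) b n)

  conv-zeroˡ : ∀ {A} B → (∀ k → A k ≡ + 0) → conv A B ≗ (λ _ → + 0)
  conv-zeroˡ B z zero    = cong (_* B 0) (z 0)
  conv-zeroˡ B z (suc n) = cong₂ _+_ (cong (_* B (suc n)) (z 0)) (conv-zeroˡ B (z ∘ suc) n)

  conv-identityˡ : ∀ B → conv one B ≗ B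
  conv-identityˡ B zero    = ℤ.*-identityˡ (B 0)
  conv-identityˡ B (suc n) =
    cong₂ _+_ (ℤ.*-identityˡ (B (suc n))) (conv-zeroˡ B (λ _ → refl) n) ⟨ trans ⟩ ℤ.+-identityʳ _

  conv-distribʳ : ∀ A B C → conv (A ⊕ B) C ≗ λ n → conv A C n + conv B C n
  conv-distribʳ A B C zero    = ℤ.*-distribʳ-+ (C 0) (A 0) (B 0)
  conv-distribʳ A B C (suc n) =
    cong₂ _+_ (ℤ.*-distribʳ-+ (C (suc n)) (A 0) (B 0)) (conv-distribʳ (tail A) (tail B) C n)
    ⟨ trans ⟩ middle-swap (A 0 * C (suc n)) (B 0 * C (suc n)) (conv (tail A) C n) (conv (tail B) C n)
    where
    middle-swap : ∀ a b c d → (a + b) + (c + d) ≡ (a + c) + (b + d)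
    middle-swap = solve-∀

  conv-scaleˡ : ∀ c A B → conv (λ k → c * A k) B ≗ λ n → c * conv A B n
  conv-scaleˡ c A B zero    = ℤ.*-assoc c (A 0) (B 0)
  conv-scaleˡ c A B (suc n) =
    cong₂ _+_ (ℤ.*-assoc c (A 0) (B (suc n))) (conv-scaleˡ c (tail A) B n)
    ⟨ trans ⟩ sym (ℤ.*-distribˡ-+ c (A 0 * B (suc n)) (conv (tail A) B n))

  conv-sucʳ : ∀ A B n → conv A B (suc n) ≡ conv A (tail B) n + A (suc n) * B 0
  conv-sucʳ A B zero    = refl
  conv-sucʳ A B (suc n) =
    cong (_+_ (A 0 * B (suc (suc n)))) (conv-sucʳ (tail A) B n)
    ⟨ trans ⟩ sym (ℤ.+-assoc (A 0 * B (suc (suc n))) (conv (tail A) (tail B) n) (A (suc (suc n)) * B 0))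

  conv-comm : ∀ A B → conv A B ≗ conv B A
  conv-comm A B zero    = ℤ.*-comm (A 0) (B 0)
  conv-comm A B (suc n) =
    cong₂ _+_ (ℤ.*-comm (A 0) (B (suc n))) (conv-comm (tail A) B n)
    ⟨ trans ⟩ ℤ.+-comm (B (suc n) * A 0) (conv B (tail A) n)
    ⟨ trans ⟩ sym (conv-sucʳ B A n)

  conv-assoc : ∀ A B C → conv (conv A B) C ≗ conv A (conv B C)
  conv-assoc A B C zero    = ℤ.*-assoc (A 0) (B 0) (C 0)
  conv-assoc A B C (suc n) =
    cong (_+_ (A 0 * B 0 * C (suc n)))
      (conv-distribʳ (λ k → A 0 * B (suc k)) (conv (tail A) B) C n
       ⟨ trans ⟩ cong₂ _+_ (conv-scaleˡ (A 0) (tail B) C n) (conv-assoc (tail A) B C n))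
    ⟨ trans ⟩ regroup (A 0) (B 0) (C (suc n)) (conv (tail B) C n) (conv (tail A) (conv B C) n)
    where
    regroup : ∀ a b c d e → a * b * c + (a * d + e) ≡ a * (b * c + d) + e
    regroup = solve-∀

  ⊛-cong : ∀ {A A′ B B′} → A ≗ A′ → B ≗ B′ → A ⊛ B ≗ A′ ⊛ B′
  ⊛-cong {A} {A′} {B} {B′} a b n =
    trans (⊛≗conv A B n) (trans (conv-cong a b n) (sym (⊛≗conv A′ B′ n)))

  ⊛-comm : ∀ A B → A ⊛ B ≗ B ⊛ A
  ⊛-comm A B n = trans (⊛≗conv A B n) (trans (conv-comm A B n) (sym (⊛≗conv B A n)))

  ⊛-assoc : ∀ A B C → (A ⊛ B) ⊛ C ≗ A ⊛ (B ⊛ C)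
  ⊛-assoc A B C n = begin
    ((A ⊛ B) ⊛ C) n      ≡⟨ ⊛≗conv (A ⊛ B) C n ⟩
    conv (A ⊛ B) C n      ≡⟨ conv-cong (⊛≗conv A B) (λ _ → refl) n ⟩
    conv (conv A B) C n   ≡⟨ conv-assoc A B C n ⟩
    conv A (conv B C) n   ≡⟨ conv-cong (λ _ → refl) (sym ∘ ⊛≗conv B C) n ⟩
    conv A (B ⊛ C) n      ≡⟨ ⊛≗conv A (B ⊛ C) n ⟨
    (A ⊛ (B ⊛ C)) n       ∎
    where open ≡-Reasoning

  ⊛-identityˡ : ∀ A → one ⊛ A ≗ A
  ⊛-identityˡ A n = trans (⊛≗conv one A n) (conv-identityˡ A n)

  ⊛-identityʳ : ∀ A → A ⊛ one ≗ A
  ⊛-identityʳ A n = trans (⊛-comm A one n) (⊛-identityˡ A n)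

  ⊛-distribʳ : ∀ C A B → (A ⊕ B) ⊛ C ≗ A ⊛ C ⊕ B ⊛ C
  ⊛-distribʳ C A B n =
    trans (⊛≗conv (A ⊕ B) C n)
          (trans (conv-distribʳ A B C n) (sym (cong₂ _+_ (⊛≗conv A C n) (⊛≗conv B C n))))

  ⊛-distribˡ : ∀ C A B → C ⊛ (A ⊕ B) ≗ C ⊛ A ⊕ C ⊛ B
  ⊛-distribˡ C A B n =
    trans (⊛-comm C (A ⊕ B) n)
          (trans (⊛-distribʳ C A B n) (cong₂ _+_ (⊛-comm A C n) (⊛-comm B C n)))

  commutativeRing : CommutativeRing 0ℓ 0ℓ
  commutativeRing = record
    { Carrier = PS ; _≈_ = _≗_ ; _+_ = _⊕_ ; _*_ = _⊛_ ; -_ = neg ; 0# = λ _ → + 0 ; 1# = one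
    ; isCommutativeRing = record
      { isRing = record
        { +-isAbelianGroup = record
          { isGroup = record
            { isMonoid = record
              { isSemigroup = record
                { isMagma = record
                  { isEquivalence = record
                    { refl = λ _ → refl ; sym = λ p n → sym (p n) ; trans = λ p q n → trans (p n) (q n) }
                  ; ∙-cong = λ p q n → cong₂ _+_ (p n) (q n) }
                ; assoc = λ A B C n → ℤ.+-assoc (A n) (B n) (C n) }
              ; identity = (λ A n → ℤ.+-identityˡ (A n)) , (λ A n → ℤ.+-identityʳ (A n)) }
            ; inverse = (λ A n → ℤ.+-inverseˡ (A n)) , (λ A n → ℤ.+-inverseʳ (A n))
            ; ⁻¹-cong = λ p n → cong -_ (p n) }
          ; comm = λ A B n → ℤ.+-comm (A n) (B n) }
        ; *-cong = ⊛-cong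
        ; *-assoc = ⊛-assoc
        ; *-identity = ⊛-identityˡ , ⊛-identityʳ
        ; distrib = ⊛-distribˡ , ⊛-distribʳ }
      ; *-comm = ⊛-comm } }

  module R = CommutativeRing commutativeRing

  X⊛-zero : ∀ B → (X ⊛ B) 0 ≡ + 0
  X⊛-zero B = trans (⊛≗conv X B 0) (ℤ.*-zeroˡ (B 0))

  X⊛-suc : ∀ B n → (X ⊛ B) (suc n) ≡ B n
  X⊛-suc B n = begin
    (X ⊛ B) (suc n)              ≡⟨ ⊛≗conv X B (suc n) ⟩
    + 0 * B (suc n) + conv one B n ≡⟨ cong (_+ conv one B n) (ℤ.*-zeroˡ (B (suc n))) ⟩
    + 0 + conv one B n          ≡⟨ ℤ.+-identityˡ _ ⟩
    conv one B n                ≡⟨ conv-identityˡ B n ⟩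
    B n                         ∎
    where open ≡-Reasoning

  ≗-cst⊕X⊛ : ∀ {A B c} → A 0 ≡ c → tail A ≗ B → A ≗ cst c ⊕ X ⊛ B
  ≗-cst⊕X⊛ {B = B} {c} A₀ A′ zero    = trans A₀ (sym (trans (cong (_+_ c) (X⊛-zero B)) (ℤ.+-identityʳ c)))
  ≗-cst⊕X⊛ {B = B}     A₀ A′ (suc n) = trans (A′ n) (sym (trans (cong (_+_ (+ 0)) (X⊛-suc B n)) (ℤ.+-identityˡ (B n))))

  cst-+ : ∀ a b → cst (a + b) ≗ cst a ⊕ cst b
  cst-+ a b zero    = refl
  cst-+ a b (suc n) = refl

  cst-* : ∀ a b → cst (a * b) ≗ cst a ⊛ cst b
  cst-* a b zero    = sym (⊛≗conv (cst a) (cst b) 0)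
  cst-* a b (suc n) = sym (trans (⊛≗conv (cst a) (cst b) (suc n))
    (cong₂ _+_ (ℤ.*-zeroʳ a) (conv-zeroˡ (cst b) (λ _ → refl) n)))

  cst-neg : ∀ a → cst (- a) ≗ neg (cst a)
  cst-neg a zero    = refl
  cst-neg a (suc n) = refl

  open import Algebra.Solver.Ring.AlmostCommutativeRing
    using (fromCommutativeRing; _-Raw-AlmostCommutative⟶_)

  cst-homomorphism : Ring.rawRing ℤ.+-*-ring -Raw-AlmostCommutative⟶ fromCommutativeRing commutativeRing
  cst-homomorphism = record
    { ⟦_⟧    = cst
    ; +-homo = cst-+
    ; *-homo = cst-*
    ; -‿homo = cst-neg
    ; 0-homo = λ { zero → refl ; (suc n) → refl }
    ; 1-homo = λ _ → refl
    }

  cst-≟ : ∀ a b → Maybe (cst a ≗ cst b)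
  cst-≟ a b with a ℤ.≟ b
  ... | yes refl = just λ _ → refl
  ... | no _     = nothing

  open import Algebra.Solver.Ring (Ring.rawRing ℤ.+-*-ring) (fromCommutativeRing commutativeRing) cst-homomorphism cst-≟
    public using (solve; Polynomial; _:+_; _:*_; _:-_; :-_; con; _:=_)

  horner : List ℤ → PS
  horner []       = cst (+ 0)
  horner (c ∷ cs) = cst c ⊕ X ⊛ horner cs

  hornerₑ : ∀ {k} → List ℤ → Polynomial k → Polynomial k
  hornerₑ []       x = con (+ 0)
  hornerₑ (c ∷ cs) x = con c :+ x :* hornerₑ cs x

  poly≗horner : ∀ cs → poly cs ≗ horner cs
  poly≗horner []       zero    = refl
  poly≗horner []       (suc n) = refl
  poly≗horner (c ∷ cs) =
    R.trans (≗-cst⊕X⊛ {B = poly cs} refl (λ _ → refl)) (R.+-congˡ {cst c} (R.*-congˡ {X} (poly≗horner cs)))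

  cst⊛ : ∀ c A n → (cst c ⊛ A) n ≡ c * A n
  cst⊛ c A zero    = ⊛≗conv (cst c) A 0
  cst⊛ c A (suc n) = begin
    (cst c ⊛ A) (suc n)                    ≡⟨ ⊛≗conv (cst c) A (suc n) ⟩
    c * A (suc n) + conv (tail (cst c)) A n ≡⟨ cong (_+_ (c * A (suc n))) (conv-zeroˡ A (λ _ → refl) n) ⟩
    c * A (suc n) + + 0                    ≡⟨ ℤ.+-identityʳ _ ⟩
    c * A (suc n)                          ∎
    where open ≡-Reasoning

  poly-scale : ∀ c cs → poly (map (c *_) cs) ≗ cst c ⊛ poly cs
  poly-scale c cs n = trans (scale c cs n) (sym (cst⊛ c (poly cs) n))
    where
    scale : ∀ c cs n → poly (map (c *_) cs) n ≡ c * poly cs n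
    scale c []       n       = sym (ℤ.*-zeroʳ c)
    scale c (d ∷ cs) zero    = refl
    scale c (d ∷ cs) (suc n) = scale c cs n

  embed-⊛ : ∀ a b n → (embed a ⊛ embed b) n ≡ + csum (λ i j → a i ℕ.* b j) n
  embed-⊛ a b n = trans (⊛≗conv (embed a) (embed b) n) (conv-embed a b n)
    where
    conv-embed : ∀ a b n → conv (embed a) (embed b) n ≡ + csum (λ i j → a i ℕ.* b j) n
    conv-embed a b zero    = sym (ℤ.pos-* (a 0) (b 0))
    conv-embed a b (suc n) =
      trans (cong₂ _+_ (sym (ℤ.pos-* (a 0) (b (suc n)))) (conv-embed (a ∘ suc) b n))
            (sym (ℤ.pos-+ (a 0 ℕ.* b (suc n)) _))

  ≗-by-residual : ∀ {L R K A B} → L ≗ R ⊕ K ⊛ (A ⊕ neg B) → A ≗ B → L ≗ R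
  ≗-by-residual {R = R} {K} {A} {B} L≗ A≗B = R.trans L≗ (R.trans (R.+-congˡ {R} (R.trans (R.*-congˡ {K} residual≗0) (R.zeroʳ K)))
                                                                  (R.+-identityʳ R))
    where
    residual≗0 : A ⊕ neg B ≗ λ _ → + 0
    residual≗0 n = trans (cong (_- B n) (A≗B n)) (ℤ.+-inverseʳ (B n))

  -- (A − 2BF)² = A² − 4B(AF − BF²) and AF − BF² = 1: the quadratic formula without division.
  quadratic-discriminant : ∀ A B F → A ⊛ F ≗ one ⊕ B ⊛ (F ⊛ F) →
    (A ⊖ cst (+ 2) ⊛ B ⊛ F) ⊛ (A ⊖ cst (+ 2) ⊛ B ⊛ F) ≗ A ⊛ A ⊖ cst (+ 4) ⊛ B
  quadratic-discriminant A B F = ≗-by-residual {K = neg (cst (+ 4) ⊛ B)}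
    (solve 3 (λ A B F → (A :- con (+ 2) :* B :* F) :* (A :- con (+ 2) :* B :* F)
                     := (A :* A :- con (+ 4) :* B) :+ :- (con (+ 4) :* B) :* (A :* F :- (con (+ 1) :+ B :* (F :* F))))
             R.refl A B F)

  quadratic-closed-form : ∀ (P B D : List ℤ) F →
    horner (+ 1 ∷ P) ⊛ F ≗ one ⊕ horner (+ 0 ∷ B) ⊛ (F ⊛ F) →
    horner D ≗ horner (+ 1 ∷ P) ⊛ horner (+ 1 ∷ P) ⊖ cst (+ 4) ⊛ horner (+ 0 ∷ B) →
    ∃[ G ] ((∀ n → (G ⊛ G) n ≡ poly D n)
            × G 0 ≡ + 1
            × (∀ n → (poly (map (+ 2 *_) (+ 0 ∷ B)) ⊛ F) n ≡ (poly (+ 1 ∷ P) ⊖ G) n))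
  quadratic-closed-form P B D F eq disc = G , G⊛G≗D , G₀≡1 , λ n → sym (a-[a-b]≡b (A n) ((Q ⊛ F) n))
    where
    A = poly (+ 1 ∷ P)
    Q = poly (map (+ 2 *_) (+ 0 ∷ B))
    G = A ⊖ Q ⊛ F
    a-[a-b]≡b : ∀ a b → a - (a - b) ≡ b
    a-[a-b]≡b = solve-∀
    A≗ : A ≗ horner (+ 1 ∷ P)
    A≗ = poly≗horner (+ 1 ∷ P)
    B≗ : poly (+ 0 ∷ B) ≗ horner (+ 0 ∷ B)
    B≗ = poly≗horner (+ 0 ∷ B)
    G≗ : G ≗ horner (+ 1 ∷ P) ⊖ cst (+ 2) ⊛ horner (+ 0 ∷ B) ⊛ F
    G≗ = R.+-cong A≗ (R.-‿cong (R.*-congʳ {F} (R.trans (poly-scale (+ 2) (+ 0 ∷ B)) (R.*-congˡ {cst (+ 2)} B≗))))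
    G⊛G≗D : G ⊛ G ≗ poly D
    G⊛G≗D = R.trans (R.*-cong G≗ G≗)
              (R.trans (quadratic-discriminant (horner (+ 1 ∷ P)) (horner (+ 0 ∷ B)) F eq) (R.sym (R.trans (poly≗horner D) disc)))
    G₀≡1 : G 0 ≡ + 1
    G₀≡1 = cong (_-_ (+ 1)) (trans (⊛≗conv Q F 0) (ℤ.*-zeroˡ (F 0)))

module Counting where

  open import Data.Bool using (Bool; true; false; _∧_; T; T?)
  open import Data.Nat using (ℕ; suc; _+_; _*_)
  open import Data.List using (List; []; _∷_; _++_; map; concatMap; length; filterᵇ)
  open import Data.Nat.ListAction using (sum)
  open import Data.List.Properties using (length-++; filter-++)
  open import Data.List.Membership.Propositional using (_∈_; find)
  open import Data.List.Membership.Propositional.Properties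
    using (∈-filter⁻; ∈-filter⁺; ∈-concatMap⁻)
  open import Data.List.Membership.Propositional.Properties.WithK using (unique∧set⇒bag)
  open import Data.List.Relation.Binary.BagAndSetEquality using (∼bag⇒↭)
  open import Data.List.Relation.Binary.Permutation.Propositional.Properties using (↭-length)
  open import Data.List.Relation.Unary.All as All using (All; []; _∷_)
  import Data.List.Relation.Unary.All.Properties as All
  open import Data.List.Relation.Unary.AllPairs using ([]; _∷_)
  open import Data.List.Relation.Unary.Any using (here; there)
  open import Data.List.Relation.Unary.Unique.Propositional using (Unique)
  import Data.List.Relation.Unary.Unique.Propositional.Properties as Unique
  open import Data.Product using (_×_; _,_)
  open import Function using (_∘_; _⇔_; mk⇔; Equivalence)
  open import Relation.Binary.PropositionalEquality

  private variable A B : Set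

  count : (A → Bool) → List A → ℕ
  count p xs = length (filterᵇ p xs)

  count-unique-bijection : ∀ {p : A → Bool} {q xs ys} → Unique xs → Unique ys →
    (∀ {z} → (z ∈ xs × T (p z)) ⇔ (z ∈ ys × T (q z))) → count p xs ≡ count q ys
  count-unique-bijection {p = p} {q} {xs} {ys} !xs !ys equiv = ↭-length (∼bag⇒↭ (unique∧set⇒bag
    (Unique.filter⁺ (T? ∘ p) !xs) (Unique.filter⁺ (T? ∘ q) !ys)
    (mk⇔ (filtered (Equivalence.to equiv)) (filtered (Equivalence.from equiv)))))
    where
    filtered : ∀ {p q : A → Bool} {xs ys z} → (z ∈ xs × T (p z) → z ∈ ys × T (q z)) →
               z ∈ filterᵇ p xs → z ∈ filterᵇ q ys
    filtered {p = p} {q} {xs} f z∈ with f (∈-filter⁻ (T? ∘ p) {xs = xs} z∈)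
    ... | z∈ys , qz = ∈-filter⁺ (T? ∘ q) z∈ys qz

  count-++ : ∀ (p : A → Bool) xs ys → count p (xs ++ ys) ≡ count p xs + count p ys
  count-++ p xs ys = trans (cong length (filter-++ (T? ∘ p) xs ys)) (length-++ (filterᵇ p xs))

  count-concatMap : ∀ (p : B → Bool) (f : A → List B) xs →
                    count p (concatMap f xs) ≡ sum (map (count p ∘ f) xs)
  count-concatMap p f []       = refl
  count-concatMap p f (x ∷ xs) =
    trans (count-++ p (f x) (concatMap f xs)) (cong (count p (f x) +_) (count-concatMap p f xs))

  count-map : ∀ (p : B → Bool) (f : A → B) xs → count p (map f xs) ≡ count (p ∘ f) xs
  count-map p f []       = refl
  count-map p f (x ∷ xs) with p (f x)
  ... | true  = cong suc (count-map p f xs)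
  ... | false = count-map p f xs

  count-cong : ∀ {p q : A → Bool} xs → (∀ {x} → x ∈ xs → p x ≡ q x) → count p xs ≡ count q xs
  count-cong         []       eq = refl
  count-cong {q = q} (x ∷ xs) eq rewrite eq (here refl) with q x
  ... | true  = cong suc (count-cong xs (eq ∘ there))
  ... | false = count-cong xs (eq ∘ there)

  count-filterᵇ : ∀ (p q : A → Bool) xs → count q (filterᵇ p xs) ≡ count (λ x → p x ∧ q x) xs
  count-filterᵇ p q []       = refl
  count-filterᵇ p q (x ∷ xs) with p x
  ... | false = count-filterᵇ p q xs
  ... | true with q x
  ...   | true  = cong suc (count-filterᵇ p q xs)
  ...   | false = count-filterᵇ p q xs

  count-false : ∀ (xs : List A) → count (λ _ → false) xs ≡ 0
  count-false []       = refl
  count-false (x ∷ xs) = count-false xs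

  sum-count-∧ : ∀ (p : A → Bool) (q : B → Bool) xs ys →
                sum (map (λ x → count (λ y → p x ∧ q y) ys) xs) ≡ count p xs * count q ys
  sum-count-∧ p q []       ys = refl
  sum-count-∧ p q (x ∷ xs) ys with p x
  ... | true  = cong (count q ys +_) (sum-count-∧ p q xs ys)
  ... | false = trans (cong (_+ sum (map (λ x → count (λ y → p x ∧ q y) ys) xs)) (count-false ys))
                      (sum-count-∧ p q xs ys)

  concatMap-unique : ∀ {f : A → List B} {xs} → Unique xs → (∀ {x} → x ∈ xs → Unique (f x)) →
    (∀ {x y z} → x ∈ xs → y ∈ xs → z ∈ f x → z ∈ f y → x ≡ y) → Unique (concatMap f xs)
  concatMap-unique {xs = []}     _          _      _        = []
  concatMap-unique {f = f} {xs = x ∷ xs} (x∉xs ∷ !xs) !f images-disjoint =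
    Unique.++⁺ (!f (here refl)) (concatMap-unique !xs (!f ∘ there) (λ p q → images-disjoint (there p) (there q)))
      λ (z∈fx , z∈rest) → let (y , y∈xs , z∈fy) = find (∈-concatMap⁻ f {xs = xs} z∈rest)
                           in All.lookup x∉xs y∈xs (images-disjoint (here refl) (there y∈xs) z∈fx z∈fy)

  map-unique : ∀ {f : A → B} {xs} → Unique xs → (∀ {x y} → x ∈ xs → y ∈ xs → f x ≡ f y → x ≡ y) →
               Unique (map f xs)
  map-unique {xs = []}     _            _   = []
  map-unique {xs = x ∷ xs} (x∉xs ∷ !xs) inj =
    All.map⁺ (All.tabulate λ y∈ fx≡fy → All.lookup x∉xs y∈ (inj (here refl) (there y∈) fx≡fy))
    ∷ map-unique !xs (λ p q → inj (there p) (there q))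

module Permutations where

  open import Defs using (insertAll; perms)
  open Counting using (concatMap-unique)
  open import Data.Nat using (ℕ; zero; suc; _+_; _≤_; _<_; z≤n; s≤s)
  open import Data.Nat.Properties
  open import Data.List using (List; []; _∷_; _++_; map; length; applyDownFrom)
  open import Data.List.Properties using (length-applyDownFrom; length-++; length-++-sucʳ; ++-assoc; ∷-injective)
  open import Data.List.Membership.Propositional using (_∈_; _∉_; find; lose)
  open import Data.List.Membership.Propositional.Properties
    using (∈-map⁺; ∈-map⁻; ∈-++⁻; ∈-++⁺ˡ; ∈-++⁺ʳ; ∈-∃++; ∈-concatMap⁺; ∈-concatMap⁻)
  open import Data.List.Relation.Binary.Permutation.Propositional using (_↭_; ↭-sym; ↭-trans; prep; refl; ↭⇒↭ₛ)
  open import Data.List.Relation.Binary.Permutation.Propositional.Properties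
    using (∈-resp-↭; ↭-length; shift; drop-mid; ↭-empty-inv)
  open import Data.List.Relation.Unary.All as All using ([])
  open import Data.List.Relation.Unary.AllPairs using ([]; _∷_)
  open import Data.List.Relation.Unary.Any using (here; there)
  open import Data.List.Relation.Unary.Unique.Propositional using (Unique)
  import Data.List.Relation.Unary.Unique.Propositional.Properties as Unique
  open import Data.Product using (∃₂; _×_; _,_; proj₁; proj₂)
  open import Data.Sum using (inj₁; inj₂)
  open import Data.Empty using (⊥-elim)
  open import Function using (_∘_)
  open import Relation.Binary.PropositionalEquality as ≡ using (_≡_; cong; subst)
  open import Data.List.Relation.Binary.Permutation.Setoid.Properties (≡.setoid ℕ) using (Unique-resp-↭)

  values : ℕ → List ℕ
  values = applyDownFrom suc

  raise : ℕ → List ℕ → List ℕ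
  raise j = map (_+ j)

  IsPerm : ℕ → List ℕ → Set
  IsPerm k σ = σ ↭ values k

  ∈-values⁻ : ∀ {k x} → x ∈ values k → 0 < x × x ≤ k
  ∈-values⁻ {suc k} (here ≡.refl) = s≤s z≤n , ≤-refl
  ∈-values⁻ {suc k} (there x∈)    = let (0<x , x≤k) = ∈-values⁻ x∈ in 0<x , m≤n⇒m≤1+n x≤k

  ∈-perm⁻ : ∀ {k σ x} → IsPerm k σ → x ∈ σ → 0 < x × x ≤ k
  ∈-perm⁻ σ↭ x∈σ = ∈-values⁻ (∈-resp-↭ σ↭ x∈σ)

  perm-length : ∀ {k σ} → IsPerm k σ → length σ ≡ k
  perm-length {k} σ↭ = ≡.trans (↭-length σ↭) (length-applyDownFrom suc k)

  ∈-raise⁻ : ∀ {i j α x} → IsPerm i α → x ∈ raise j α → j < x × x ≤ i + j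
  ∈-raise⁻ {j = j} α↭ x∈ with ∈-map⁻ (_+ j) x∈
  ... | x′ , x′∈ , ≡.refl = let (0<x′ , x′≤i) = ∈-perm⁻ α↭ x′∈ in +-monoˡ-≤ j 0<x′ , +-monoˡ-≤ j x′≤i

  values-unique : ∀ k → Unique (values k)
  values-unique zero    = []
  values-unique (suc k) = All.tabulate (λ x∈ eq → ≤⇒≯ (proj₂ (∈-values⁻ x∈)) (≤-reflexive eq)) ∷ values-unique k

  perm-unique : ∀ {k σ} → IsPerm k σ → Unique σ
  perm-unique {k} σ↭ = Unique-resp-↭ (↭⇒↭ₛ (↭-sym σ↭)) (values-unique k)

  values-+ : ∀ i j → values (i + j) ≡ raise j (values i) ++ values j
  values-+ zero    j = ≡.refl
  values-+ (suc i) j = cong (suc (i + j) ∷_) (values-+ i j)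

  ++-∷-injective : ∀ {x : ℕ} a a′ {b b′} → x ∉ a → x ∉ a′ → a ++ x ∷ b ≡ a′ ++ x ∷ b′ → a ≡ a′ × b ≡ b′
  ++-∷-injective []      []       _    _     eq = ≡.refl , proj₂ (∷-injective eq)
  ++-∷-injective []      (y ∷ a′) _    x∉a′  eq = ⊥-elim (x∉a′ (here (proj₁ (∷-injective eq))))
  ++-∷-injective (y ∷ a) []       x∉a  _     eq = ⊥-elim (x∉a (here (≡.sym (proj₁ (∷-injective eq)))))
  ++-∷-injective (y ∷ a) (y′ ∷ a′) x∉a x∉a′  eq with ∷-injective eq
  ... | ≡.refl , eq′ with ++-∷-injective a a′ (x∉a ∘ there) (x∉a′ ∘ there) eq′
  ...   | ≡.refl , ≡.refl = ≡.refl , ≡.refl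

  ∈-insert : ∀ {v x : ℕ} a {b} → v ∈ a ++ b → v ∈ a ++ x ∷ b
  ∈-insert a v∈ with ∈-++⁻ a v∈
  ... | inj₁ v∈a = ∈-++⁺ˡ v∈a
  ... | inj₂ v∈b = ∈-++⁺ʳ a (there v∈b)

  unique-++-disjoint : ∀ (a : List ℕ) {b x} → Unique (a ++ b) → x ∈ a → x ∉ b
  unique-++-disjoint (y ∷ a) (y∉ ∷ _)  (here ≡.refl) x∈b = All.lookup y∉ (∈-++⁺ʳ a x∈b) ≡.refl
  unique-++-disjoint (y ∷ a) (_ ∷ !ab) (there x∈a)   x∈b = unique-++-disjoint a !ab x∈a x∈b

  insertAll⁻ : ∀ {x σ} π → σ ∈ insertAll x π → ∃₂ λ a b → π ≡ a ++ b × σ ≡ a ++ x ∷ b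
  insertAll⁻ []       (here ≡.refl) = [] , [] , ≡.refl , ≡.refl
  insertAll⁻ (y ∷ π)  (here ≡.refl) = [] , y ∷ π , ≡.refl , ≡.refl
  insertAll⁻ (y ∷ π)  (there σ∈) with ∈-map⁻ (y ∷_) σ∈
  ... | σ′ , σ′∈ , ≡.refl with insertAll⁻ π σ′∈
  ...   | a , b , ≡.refl , ≡.refl = y ∷ a , b , ≡.refl , ≡.refl

  insertAll⁺ : ∀ {x} a b → a ++ x ∷ b ∈ insertAll x (a ++ b)
  insertAll⁺ []      []      = here ≡.refl
  insertAll⁺ []      (y ∷ b) = here ≡.refl
  insertAll⁺ (y ∷ a) b       = there (∈-map⁺ (y ∷_) (insertAll⁺ a b))

  insertAll-unique : ∀ {x} π → x ∉ π → Unique (insertAll x π)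
  insertAll-unique []      _   = [] ∷ []
  insertAll-unique {x} (y ∷ π) x∉ =
    All.tabulate (λ σ∈ eq → x∉ (here (proj₁ (∷-injective (≡.trans eq (proj₂ (proj₂ (∈-map⁻ (y ∷_) σ∈))))))))
    ∷ Unique.map⁺ (proj₂ ∘ ∷-injective) (insertAll-unique π (x∉ ∘ there))

  suc∉perm : ∀ {k σ} → IsPerm k σ → suc k ∉ σ
  suc∉perm σ↭ k+1∈σ = <-irrefl ≡.refl (s≤s (proj₂ (∈-perm⁻ σ↭ k+1∈σ)))

  perms-sound : ∀ k {σ} → σ ∈ perms k → IsPerm k σ
  perms-sound zero    (here ≡.refl) = refl
  perms-sound (suc k) σ∈ with find (∈-concatMap⁻ (insertAll (suc k)) {xs = perms k} σ∈)
  ... | π , π∈ , σ∈insert with insertAll⁻ π σ∈insert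
  ...   | a , b , ≡.refl , ≡.refl = ↭-trans (shift (suc k) a b) (prep (suc k) (perms-sound k π∈))

  perms-complete : ∀ k {σ} → IsPerm k σ → σ ∈ perms k
  perms-complete zero    σ↭ rewrite ↭-empty-inv σ↭ = here ≡.refl
  perms-complete (suc k) σ↭ with ∈-∃++ (∈-resp-↭ (↭-sym σ↭) (here ≡.refl))
  ... | a , b , ≡.refl =
    ∈-concatMap⁺ (insertAll (suc k)) (lose (perms-complete k (drop-mid a [] σ↭)) (insertAll⁺ a b))

  perms-unique : ∀ k → Unique (perms k)
  perms-unique zero    = [] ∷ []
  perms-unique (suc k) = concatMap-unique (perms-unique k)
    (λ {π} π∈ → insertAll-unique π (suc∉perm (perms-sound k π∈)))
    images-disjoint
    where
    images-disjoint : ∀ {π π′ σ} → π ∈ perms k → π′ ∈ perms k →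
                      σ ∈ insertAll (suc k) π → σ ∈ insertAll (suc k) π′ → π ≡ π′
    images-disjoint {π} {π′} π∈ π′∈ σ∈ σ∈′ with insertAll⁻ π σ∈ | insertAll⁻ π′ σ∈′
    ... | a , b , ≡.refl , ≡.refl | a′ , b′ , ≡.refl , eq
      with ++-∷-injective a a′ (suc∉perm (perms-sound k π∈) ∘ ∈-++⁺ˡ) (suc∉perm (perms-sound k π′∈) ∘ ∈-++⁺ˡ) eq
    ... | ≡.refl , ≡.refl = ≡.refl

  remove-max : ∀ {m} a b ys → (a ++ suc m ∷ b) ++ ys ↭ values (suc m) → (a ++ b) ++ ys ↭ values m
  remove-max {m} a b ys p = subst (_↭ values m) (≡.sym (++-assoc a b ys))
    (drop-mid a [] (subst (_↭ values (suc m)) (++-assoc a (suc m ∷ b) ys) p))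

  -- The largest value n lies in xs unless xs is empty; remove it and recurse.
  split-values : ∀ n xs ys → xs ++ ys ↭ values n → (∀ {x y} → x ∈ xs → y ∈ ys → y < x) →
                 IsPerm (length ys) ys × xs ↭ raise (length ys) (values (length xs))
  split-values zero []       []       _ _ = refl , refl
  split-values zero []       (_ ∷ _)  p _ with () ← ↭-empty-inv p
  split-values zero (_ ∷ _)  _        p _ with () ← ↭-empty-inv p
  split-values (suc m) xs ys p ys<xs with ∈-++⁻ xs (∈-resp-↭ (↭-sym p) (here ≡.refl))
  split-values (suc m) []       ys p ys<xs | inj₂ _ =
    subst (λ k → ys ↭ values k) (≡.sym (≡.trans (↭-length p) (length-applyDownFrom suc (suc m)))) p , refl
  split-values (suc m) (x ∷ xs) ys p ys<xs | inj₂ top∈ys =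
    ⊥-elim (<-irrefl ≡.refl (<-≤-trans (ys<xs (here ≡.refl) top∈ys) (proj₂ (∈-values⁻ (∈-resp-↭ p (here ≡.refl))))))
  split-values (suc m) xs ys p ys<xs | inj₁ top∈xs with ∈-∃++ top∈xs
  ... | a , b , ≡.refl with split-values m (a ++ b) ys (remove-max a b ys p) (λ x∈ y∈ → ys<xs (∈-insert a x∈) y∈)
  ...   | ys↭ , ab↭ = ys↭ ,
    subst (λ k → a ++ suc m ∷ b ↭ raise (length ys) (values k)) (≡.sym (length-++-sucʳ a (suc m) b))
      (subst (λ k → a ++ suc m ∷ b ↭ suc k ∷ raise (length ys) (values (length (a ++ b)))) m≡
        (↭-trans (shift (suc m) a b) (prep (suc m) ab↭)))
    where
    m≡ : m ≡ length (a ++ b) + length ys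
    m≡ = ≡.trans (≡.sym (length-applyDownFrom suc m))
                 (≡.trans (≡.sym (↭-length (remove-max a b ys p))) (length-++ (a ++ b)))

module TriplePatterns where

  open import Defs using (contains; dashless; choose; adjOK; orderIso; at; _==ᵇ_)
  open import Data.Nat using (ℕ; zero; suc; _+_; _≤_; _<_; z≤n; s≤s; _<ᵇ_; _≡ᵇ_)
  open import Data.Nat.Properties
    using (<⇒<ᵇ; <ᵇ⇒<; ≤-refl; <-irrefl; <-≤-trans; +-monoˡ-<; m≤n+m)
  open import Data.Bool using (Bool; true; false; _∧_; _∨_; not; T)
  open import Data.Bool.Properties using (∨-identityʳ; ∨-assoc)
  open import Data.Bool.ListAction using (any)
  open import Data.List using (List; []; _∷_; _++_; map; foldr; upTo; length)
  open import Data.List.Properties using (map-++; map-∘; map-cong; map-upTo; ++-is-foldr)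
  open import Data.Product using (_×_; _,_)
  open import Data.Empty using (⊥-elim)
  open import Function using (_∘_)
  open import Relation.Binary.PropositionalEquality

  <ᵇ-true : ∀ {x y} → x < y → (x <ᵇ y) ≡ true
  <ᵇ-true {x} {y} x<y with x <ᵇ y | <⇒<ᵇ x<y
  ... | true | _ = refl

  <ᵇ-true⁻ : ∀ {x y} → (x <ᵇ y) ≡ true → x < y
  <ᵇ-true⁻ {x} {y} eq = <ᵇ⇒< x y (subst T (sym eq) _)

  <ᵇ-false : ∀ {x y} → y ≤ x → (x <ᵇ y) ≡ false
  <ᵇ-false {x} {y} y≤x with x <ᵇ y in eq
  ... | true  = ⊥-elim (<-irrefl refl (<-≤-trans (<ᵇ-true⁻ eq) y≤x))
  ... | false = refl

  <ᵇ-irrefl : ∀ x → (x <ᵇ x) ≡ false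
  <ᵇ-irrefl x = <ᵇ-false (≤-refl {x})

  <ᵇ-+ʳ : ∀ x y j → (x + j <ᵇ y + j) ≡ (x <ᵇ y)
  <ᵇ-+ʳ zero    zero    j = <ᵇ-irrefl j
  <ᵇ-+ʳ zero    (suc y) j = <ᵇ-true (+-monoˡ-< j (s≤s z≤n))
  <ᵇ-+ʳ (suc x) zero    j = <ᵇ-false (m≤n+m j (suc x))
  <ᵇ-+ʳ (suc x) (suc y) j = <ᵇ-+ʳ x y j

  matches : ℕ → ℕ → ℕ → ℕ → ℕ → ℕ → Bool
  matches a b c x y z = orderIso (x ∷ y ∷ z ∷ []) (a ∷ b ∷ c ∷ [])

  record SameOrder (x y z x′ y′ z′ : ℕ) : Set where
    constructor sameOrder
    field
      xy : (x <ᵇ y) ≡ (x′ <ᵇ y′)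
      xz : (x <ᵇ z) ≡ (x′ <ᵇ z′)
      yx : (y <ᵇ x) ≡ (y′ <ᵇ x′)
      yz : (y <ᵇ z) ≡ (y′ <ᵇ z′)
      zx : (z <ᵇ x) ≡ (z′ <ᵇ x′)
      zy : (z <ᵇ y) ≡ (z′ <ᵇ y′)

  -- orderIso also compares every entry with itself; those comparisons are always false.
  orderIso-triple : ∀ x y z a b c → matches a b c x y z ≡
    ((x <ᵇ y) ==ᵇ (a <ᵇ b)) ∧ (((x <ᵇ z) ==ᵇ (a <ᵇ c)) ∧ (((y <ᵇ x) ==ᵇ (b <ᵇ a)) ∧
    (((y <ᵇ z) ==ᵇ (b <ᵇ c)) ∧ (((z <ᵇ x) ==ᵇ (c <ᵇ a)) ∧ (((z <ᵇ y) ==ᵇ (c <ᵇ b)) ∧ true)))))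
  orderIso-triple x y z a b c
    rewrite <ᵇ-irrefl x | <ᵇ-irrefl y | <ᵇ-irrefl z | <ᵇ-irrefl a | <ᵇ-irrefl b | <ᵇ-irrefl c = refl

  matches-cong : ∀ {x y z x′ y′ z′} a b c → SameOrder x y z x′ y′ z′ → matches a b c x y z ≡ matches a b c x′ y′ z′
  matches-cong {x} {y} {z} {x′} {y′} {z′} a b c (sameOrder e₁ e₂ e₃ e₄ e₅ e₆)
    rewrite orderIso-triple x y z a b c | orderIso-triple x′ y′ z′ a b c | e₁ | e₂ | e₃ | e₄ | e₅ | e₆ = refl

  private
    ∧-true : ∀ {p q} → p ∧ q ≡ true → p ≡ true × q ≡ true
    ∧-true {true} {true} _ = refl , refl

    ==ᵇ-true : ∀ {p q} → (p ==ᵇ q) ≡ true → p ≡ q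
    ==ᵇ-true {true}  {true}  _ = refl
    ==ᵇ-true {false} {false} _ = refl

  matches-true⁻ : ∀ {x y z a b c} → matches a b c x y z ≡ true → SameOrder x y z a b c
  matches-true⁻ {x} {y} {z} {a} {b} {c} eq
    with e₁ , r₁ ← ∧-true (trans (sym (orderIso-triple x y z a b c)) eq)
    with e₂ , r₂ ← ∧-true r₁
    with e₃ , r₃ ← ∧-true r₂
    with e₄ , r₄ ← ∧-true r₃
    with e₅ , r₅ ← ∧-true r₄
    with e₆ , _  ← ∧-true r₅
    = sameOrder (==ᵇ-true e₁) (==ᵇ-true e₂) (==ᵇ-true e₃) (==ᵇ-true e₄) (==ᵇ-true e₅) (==ᵇ-true e₆)

  matches-+ʳ : ∀ a b c x y z j → matches a b c (x + j) (y + j) (z + j) ≡ matches a b c x y z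
  matches-+ʳ a b c x y z j = matches-cong {x + j} {y + j} {z + j} {x} {y} {z} a b c
    (sameOrder (<ᵇ-+ʳ x y j) (<ᵇ-+ʳ x z j) (<ᵇ-+ʳ y x j) (<ᵇ-+ʳ y z j) (<ᵇ-+ʳ z x j) (<ᵇ-+ʳ z y j))

  anyWindow : (ℕ → ℕ → ℕ → Bool) → List ℕ → Bool
  anyWindow P (x ∷ y ∷ z ∷ r) = P x y z ∨ anyWindow P (y ∷ z ∷ r)
  anyWindow P _               = false

  choose-∷ : ∀ k i is → choose (suc k) (i ∷ is) ≡ map (i ∷_) (choose k is) ++ choose (suc k) is
  choose-∷ k i is = sym (++-is-foldr (map (i ∷_) (choose k is)) (choose (suc k) is))

  choose-map-suc : ∀ k is → choose k (map suc is) ≡ map (map suc) (choose k is)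
  choose-map-suc zero    is       = refl
  choose-map-suc (suc k) []       = refl
  choose-map-suc (suc k) (i ∷ is) = begin
    choose (suc k) (suc i ∷ map suc is)
      ≡⟨ choose-∷ k (suc i) (map suc is) ⟩
    map (suc i ∷_) (choose k (map suc is)) ++ choose (suc k) (map suc is)
      ≡⟨ cong₂ _++_ (trans (cong (map (suc i ∷_)) (choose-map-suc k is)) (trans (sym (map-∘ (choose k is))) (map-∘ (choose k is))))
                    (choose-map-suc (suc k) is) ⟩
    map (map suc) (map (i ∷_) (choose k is)) ++ map (map suc) (choose (suc k) is)
      ≡⟨ map-++ (map suc) (map (i ∷_) (choose k is)) (choose (suc k) is) ⟨
    map (map suc) (map (i ∷_) (choose k is) ++ choose (suc k) is)
      ≡⟨ cong (map (map suc)) (choose-∷ k i is) ⟨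
    map (map suc) (choose (suc k) (i ∷ is)) ∎
    where open ≡-Reasoning

  upTo-suc : ∀ n → upTo (suc n) ≡ 0 ∷ map suc (upTo n)
  upTo-suc n = cong (0 ∷_) (sym (map-upTo suc n))

  adjOK-map-suc : ∀ bs is → adjOK bs (map suc is) ≡ adjOK bs is
  adjOK-map-suc []       is           = refl
  adjOK-map-suc (b ∷ bs) []           = refl
  adjOK-map-suc (b ∷ bs) (i ∷ [])     = refl
  adjOK-map-suc (b ∷ bs) (i ∷ j ∷ is) = cong ((not b ∨ (j ≡ᵇ suc i)) ∧_) (adjOK-map-suc bs (j ∷ is))

  any-++ : ∀ {A : Set} (p : A → Bool) xs ys → any p (xs ++ ys) ≡ any p xs ∨ any p ys
  any-++ p []       ys = refl
  any-++ p (x ∷ xs) ys = trans (cong (p x ∨_) (any-++ p xs ys)) (sym (∨-assoc (p x) _ _))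

  any-map : ∀ {A B : Set} (p : B → Bool) (f : A → B) xs → any p (map f xs) ≡ any (p ∘ f) xs
  any-map p f xs = cong (foldr _∨_ false) (sym (map-∘ xs))

  any-cong : ∀ {A : Set} {p q : A → Bool} → (∀ x → p x ≡ q x) → ∀ xs → any p xs ≡ any q xs
  any-cong eq xs = cong (foldr _∨_ false) (map-cong eq xs)

  any-false : ∀ {A : Set} (xs : List A) → any (λ _ → false) xs ≡ false
  any-false []       = refl
  any-false (x ∷ xs) = any-false xs

  module _ (a b c : ℕ) where

    private
      occurs : List ℕ → List ℕ → Bool
      occurs σ is = adjOK (true ∷ true ∷ []) is ∧ orderIso (map (at σ) is) (a ∷ b ∷ c ∷ [])

      occurs-map-suc : ∀ x xs is → occurs (x ∷ xs) (map suc is) ≡ occurs xs is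
      occurs-map-suc x xs is =
        cong₂ _∧_ (adjOK-map-suc (true ∷ true ∷ []) is) (cong (λ l → orderIso l (a ∷ b ∷ c ∷ [])) (sym (map-∘ is)))

      -- an index triple starting at 0 that is not 0,1,2 fails the adjacency requirement
      occurs-gap₁ : ∀ x y ys js → occurs (x ∷ y ∷ ys) (0 ∷ map suc (map suc js)) ≡ false
      occurs-gap₁ x y ys []      = refl
      occurs-gap₁ x y ys (j ∷ _) = refl

      occurs-gap₂ : ∀ x y z zs ks → occurs (x ∷ y ∷ z ∷ zs) (0 ∷ 1 ∷ map suc (map suc (map suc ks))) ≡ false
      occurs-gap₂ x y z zs []      = refl
      occurs-gap₂ x y z zs (k ∷ _) = refl

      headWindow : ℕ → List ℕ → Bool
      headWindow x (y ∷ z ∷ _) = matches a b c x y z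
      headWindow x _           = false

      occursAtHead : ℕ → List ℕ → Bool
      occursAtHead x xs = any (λ js → occurs (x ∷ xs) (0 ∷ map suc js)) (choose 2 (upTo (length xs)))

      occursAtHead-∷ : ∀ x y ys → occursAtHead x (y ∷ ys) ≡
        any (λ ks → occurs (x ∷ y ∷ ys) (0 ∷ 1 ∷ map suc (map suc ks))) (choose 1 (upTo (length ys)))
      occursAtHead-∷ x y ys = begin
        any h (choose 2 (upTo (suc (length ys))))
          ≡⟨ cong (any h ∘ choose 2) (upTo-suc (length ys)) ⟩
        any h (choose 2 (0 ∷ map suc U))
          ≡⟨ cong (any h) (choose-∷ 1 0 (map suc U)) ⟩
        any h (map (0 ∷_) (choose 1 (map suc U)) ++ choose 2 (map suc U))
          ≡⟨ any-++ h (map (0 ∷_) (choose 1 (map suc U))) (choose 2 (map suc U)) ⟩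
        any h (map (0 ∷_) (choose 1 (map suc U))) ∨ any h (choose 2 (map suc U))
          ≡⟨ cong₂ _∨_
               (trans (any-map h (0 ∷_) (choose 1 (map suc U)))
                 (trans (cong (any (h ∘ (0 ∷_))) (choose-map-suc 1 U)) (any-map (h ∘ (0 ∷_)) (map suc) (choose 1 U))))
               (trans (cong (any h) (choose-map-suc 2 U))
                 (trans (any-map h (map suc) (choose 2 U))
                   (trans (any-cong (occurs-gap₁ x y ys) (choose 2 U)) (any-false (choose 2 U))))) ⟩
        any (λ ks → occurs (x ∷ y ∷ ys) (0 ∷ 1 ∷ map suc (map suc ks))) (choose 1 U) ∨ false
          ≡⟨ ∨-identityʳ _ ⟩
        any (λ ks → occurs (x ∷ y ∷ ys) (0 ∷ 1 ∷ map suc (map suc ks))) (choose 1 U) ∎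
        where
        open ≡-Reasoning
        U = upTo (length ys)
        h = λ js → occurs (x ∷ y ∷ ys) (0 ∷ map suc js)

      occursAtHead≡headWindow : ∀ x xs → occursAtHead x xs ≡ headWindow x xs
      occursAtHead≡headWindow x []               = refl
      occursAtHead≡headWindow x (y ∷ [])         = occursAtHead-∷ x y []
      occursAtHead≡headWindow x (y ∷ z ∷ zs) = begin
        occursAtHead x (y ∷ z ∷ zs)
          ≡⟨ occursAtHead-∷ x y (z ∷ zs) ⟩
        any h (choose 1 (upTo (suc (length zs))))
          ≡⟨ cong (any h ∘ choose 1) (upTo-suc (length zs)) ⟩
        any h (choose 1 (0 ∷ map suc U))
          ≡⟨ cong (any h) (choose-∷ 0 0 (map suc U)) ⟩
        matches a b c x y z ∨ any h (choose 1 (map suc U))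
          ≡⟨ cong (matches a b c x y z ∨_)
               (trans (cong (any h) (choose-map-suc 1 U))
                 (trans (any-map h (map suc) (choose 1 U))
                   (trans (any-cong (occurs-gap₂ x y z zs) (choose 1 U)) (any-false (choose 1 U))))) ⟩
        matches a b c x y z ∨ false
          ≡⟨ ∨-identityʳ _ ⟩
        matches a b c x y z ∎
        where
        open ≡-Reasoning
        U = upTo (length zs)
        h = λ ks → occurs (x ∷ y ∷ z ∷ zs) (0 ∷ 1 ∷ map suc (map suc ks))

      anyWindow-∷ : ∀ x xs → headWindow x xs ∨ anyWindow (matches a b c) xs ≡ anyWindow (matches a b c) (x ∷ xs)
      anyWindow-∷ x []           = refl
      anyWindow-∷ x (y ∷ [])     = refl
      anyWindow-∷ x (y ∷ z ∷ zs) = refl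

    contains-dashless : ∀ σ → contains (dashless a b c) σ ≡ anyWindow (matches a b c) σ
    contains-dashless []       = refl
    contains-dashless (x ∷ xs) = begin
      any (occurs (x ∷ xs)) (choose 3 (upTo (suc (length xs))))
        ≡⟨ cong (any (occurs (x ∷ xs)) ∘ choose 3) (upTo-suc (length xs)) ⟩
      any (occurs (x ∷ xs)) (choose 3 (0 ∷ map suc U))
        ≡⟨ cong (any (occurs (x ∷ xs))) (choose-∷ 2 0 (map suc U)) ⟩
      any (occurs (x ∷ xs)) (map (0 ∷_) (choose 2 (map suc U)) ++ choose 3 (map suc U))
        ≡⟨ any-++ (occurs (x ∷ xs)) (map (0 ∷_) (choose 2 (map suc U))) (choose 3 (map suc U)) ⟩
      any (occurs (x ∷ xs)) (map (0 ∷_) (choose 2 (map suc U))) ∨ any (occurs (x ∷ xs)) (choose 3 (map suc U))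
        ≡⟨ cong₂ _∨_ atHead (trans (cong (any (occurs (x ∷ xs))) (choose-map-suc 3 U))
                               (trans (any-map (occurs (x ∷ xs)) (map suc) (choose 3 U))
                                 (trans (any-cong (occurs-map-suc x xs) (choose 3 U)) (contains-dashless xs)))) ⟩
      headWindow x xs ∨ anyWindow (matches a b c) xs
        ≡⟨ anyWindow-∷ x xs ⟩
      anyWindow (matches a b c) (x ∷ xs) ∎
      where
      open ≡-Reasoning
      U = upTo (length xs)
      atHead : any (occurs (x ∷ xs)) (map (0 ∷_) (choose 2 (map suc U))) ≡ headWindow x xs
      atHead = begin
        any (occurs (x ∷ xs)) (map (0 ∷_) (choose 2 (map suc U)))
          ≡⟨ any-map (occurs (x ∷ xs)) (0 ∷_) (choose 2 (map suc U)) ⟩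
        any (occurs (x ∷ xs) ∘ (0 ∷_)) (choose 2 (map suc U))
          ≡⟨ cong (any (occurs (x ∷ xs) ∘ (0 ∷_))) (choose-map-suc 2 U) ⟩
        any (occurs (x ∷ xs) ∘ (0 ∷_)) (map (map suc) (choose 2 U))
          ≡⟨ any-map (occurs (x ∷ xs) ∘ (0 ∷_)) (map suc) (choose 2 U) ⟩
        occursAtHead x xs
          ≡⟨ occursAtHead≡headWindow x xs ⟩
        headWindow x xs ∎

module Pattern132 where

  open import Defs using (contains; avoids; p1-3-2; choose; adjOK; orderIso; at)
  open Permutations using (raise)
  open TriplePatterns
  open import Data.Nat using (ℕ; zero; suc; _+_; _<_)
  open import Data.Nat.Properties using (<-trans; <⇒≤; +-cancelʳ-<; +-monoˡ-<)
  open import Data.Bool using (Bool; true; false; _∧_; T)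
  open import Data.Unit using (tt)
  open import Relation.Nullary using (¬_)
  open import Data.Bool.Properties using (T-≡)
  open import Data.List.Relation.Unary.Any.Properties using (any⁺; any⁻)
  open import Data.Bool.ListAction using (any)
  open import Data.List using (List; []; _∷_; _++_; map; upTo; length)
  open import Data.List.Properties using (map-++; map-∘; map-cong)
  open import Data.List.Membership.Propositional using (_∈_; find; lose)
  open import Data.List.Membership.Propositional.Properties using (∈-++⁻; ∈-++⁺ˡ; ∈-++⁺ʳ; ∈-map⁺; ∈-map⁻)
  open import Data.List.Relation.Binary.Sublist.Propositional using (_⊆_; []; _∷_; _∷ʳ_; minimum; ⊆-trans)
  import Data.List.Relation.Binary.Sublist.Propositional.Properties as Sublist
  open import Data.List.Relation.Unary.Any using (here)
  open import Data.Product using (∃; ∃₂; _×_; _,_)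
  open import Data.Sum using (inj₁; inj₂)
  open import Function using (_∘_; Equivalence)
  open import Relation.Binary.PropositionalEquality

  sublists : ℕ → List ℕ → List (List ℕ)
  sublists zero    _        = [] ∷ []
  sublists (suc k) []       = []
  sublists (suc k) (x ∷ xs) = map (x ∷_) (sublists k xs) ++ sublists (suc k) xs

  map-at-choose : ∀ k σ → map (map (at σ)) (choose k (upTo (length σ))) ≡ sublists k σ
  map-at-choose zero    σ        = refl
  map-at-choose (suc k) []       = refl
  map-at-choose (suc k) (x ∷ xs) = begin
    map (map (at (x ∷ xs))) (choose (suc k) (upTo (suc (length xs))))
      ≡⟨ cong (map (map (at (x ∷ xs))) ∘ choose (suc k)) (upTo-suc (length xs)) ⟩
    map (map (at (x ∷ xs))) (choose (suc k) (0 ∷ map suc U))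
      ≡⟨ cong (map (map (at (x ∷ xs)))) (choose-∷ k 0 (map suc U)) ⟩
    map (map (at (x ∷ xs))) (map (0 ∷_) (choose k (map suc U)) ++ choose (suc k) (map suc U))
      ≡⟨ map-++ (map (at (x ∷ xs))) (map (0 ∷_) (choose k (map suc U))) (choose (suc k) (map suc U)) ⟩
    map (map (at (x ∷ xs))) (map (0 ∷_) (choose k (map suc U))) ++ map (map (at (x ∷ xs))) (choose (suc k) (map suc U))
      ≡⟨ cong₂ _++_ headed unheaded ⟩
    map (x ∷_) (sublists k xs) ++ sublists (suc k) xs ∎
    where
    open ≡-Reasoning
    U = upTo (length xs)
    at-suc : ∀ is → map (at (x ∷ xs)) (map suc is) ≡ map (at xs) is
    at-suc is = sym (map-∘ is)
    headed : map (map (at (x ∷ xs))) (map (0 ∷_) (choose k (map suc U))) ≡ map (x ∷_) (sublists k xs)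
    headed = begin
      map (map (at (x ∷ xs))) (map (0 ∷_) (choose k (map suc U)))
        ≡⟨ sym (map-∘ (choose k (map suc U))) ⟩
      map (λ is → x ∷ map (at (x ∷ xs)) is) (choose k (map suc U))
        ≡⟨ cong (map (λ is → x ∷ map (at (x ∷ xs)) is)) (choose-map-suc k U) ⟩
      map (λ is → x ∷ map (at (x ∷ xs)) is) (map (map suc) (choose k U))
        ≡⟨ sym (map-∘ (choose k U)) ⟩
      map (λ is → x ∷ map (at (x ∷ xs)) (map suc is)) (choose k U)
        ≡⟨ map-cong (λ is → cong (x ∷_) (at-suc is)) (choose k U) ⟩
      map (λ is → x ∷ map (at xs) is) (choose k U)
        ≡⟨ map-∘ (choose k U) ⟩
      map (x ∷_) (map (map (at xs)) (choose k U))
        ≡⟨ cong (map (x ∷_)) (map-at-choose k xs) ⟩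
      map (x ∷_) (sublists k xs) ∎
    unheaded : map (map (at (x ∷ xs))) (choose (suc k) (map suc U)) ≡ sublists (suc k) xs
    unheaded = begin
      map (map (at (x ∷ xs))) (choose (suc k) (map suc U))
        ≡⟨ cong (map (map (at (x ∷ xs)))) (choose-map-suc (suc k) U) ⟩
      map (map (at (x ∷ xs))) (map (map suc) (choose (suc k) U))
        ≡⟨ sym (map-∘ (choose (suc k) U)) ⟩
      map (map (at (x ∷ xs)) ∘ map suc) (choose (suc k) U)
        ≡⟨ map-cong at-suc (choose (suc k) U) ⟩
      map (map (at xs)) (choose (suc k) U)
        ≡⟨ map-at-choose (suc k) xs ⟩
      sublists (suc k) xs ∎

  ∈-sublists⁻ : ∀ k σ {s} → s ∈ sublists k σ → s ⊆ σ × length s ≡ k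
  ∈-sublists⁻ zero    σ        (here refl) = minimum σ , refl
  ∈-sublists⁻ (suc k) (x ∷ xs) s∈ with ∈-++⁻ (map (x ∷_) (sublists k xs)) s∈
  ... | inj₂ s∈′ = let (s⊆ , len) = ∈-sublists⁻ (suc k) xs s∈′ in x ∷ʳ s⊆ , len
  ... | inj₁ s∈′ with ∈-map⁻ (x ∷_) s∈′
  ...   | s′ , s′∈ , refl = let (s⊆ , len) = ∈-sublists⁻ k xs s′∈ in refl ∷ s⊆ , cong suc len

  ∈-sublists⁺ : ∀ {s σ} → s ⊆ σ → s ∈ sublists (length s) σ
  ∈-sublists⁺ []                     = here refl
  ∈-sublists⁺ {x ∷ s} (refl ∷ s⊆)    = ∈-++⁺ˡ (∈-map⁺ (x ∷_) (∈-sublists⁺ s⊆))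
  ∈-sublists⁺ {[]}    (y ∷ʳ s⊆)      = here refl
  ∈-sublists⁺ {x ∷ s} (y ∷ʳ s⊆)      = ∈-++⁺ʳ (map (y ∷_) (sublists (length s) _)) (∈-sublists⁺ s⊆)

  Has132 : List ℕ → Set
  Has132 σ = ∃ λ x → ∃₂ λ y z → (x ∷ y ∷ z ∷ []) ⊆ σ × x < z × z < y

  private
    adjOK-dashes : ∀ is → adjOK (false ∷ false ∷ []) is ≡ true
    adjOK-dashes []                = refl
    adjOK-dashes (i ∷ [])          = refl
    adjOK-dashes (i ∷ j ∷ [])      = refl
    adjOK-dashes (i ∷ j ∷ k ∷ is)  = refl

    contains132-sublists : ∀ σ → contains p1-3-2 σ ≡ any (λ s → orderIso s (1 ∷ 3 ∷ 2 ∷ [])) (sublists 3 σ)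
    contains132-sublists σ = begin
      any (λ is → adjOK (false ∷ false ∷ []) is ∧ orderIso (map (at σ) is) w) (choose 3 (upTo (length σ)))
        ≡⟨ any-cong (λ is → cong (_∧ orderIso (map (at σ) is) w) (adjOK-dashes is)) (choose 3 (upTo (length σ))) ⟩
      any (λ is → orderIso (map (at σ) is) w) (choose 3 (upTo (length σ)))
        ≡⟨ any-map (λ s → orderIso s w) (map (at σ)) (choose 3 (upTo (length σ))) ⟨
      any (λ s → orderIso s w) (map (map (at σ)) (choose 3 (upTo (length σ))))
        ≡⟨ cong (any (λ s → orderIso s w)) (map-at-choose 3 σ) ⟩
      any (λ s → orderIso s w) (sublists 3 σ) ∎
      where
      open ≡-Reasoning
      w = 1 ∷ 3 ∷ 2 ∷ []

  private
    sublist132⁻ : ∀ {σ} s → s ⊆ σ → length s ≡ 3 → T (orderIso s (1 ∷ 3 ∷ 2 ∷ [])) → Has132 σ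
    sublist132⁻ (x ∷ y ∷ z ∷ []) s⊆ _ s~132 =
      let order = matches-true⁻ {x} {y} {z} {1} {3} {2} (Equivalence.to T-≡ s~132)
      in x , y , z , s⊆ , <ᵇ-true⁻ (SameOrder.xz order) , <ᵇ-true⁻ (SameOrder.zy order)
    sublist132⁻ []                    _ () _
    sublist132⁻ (_ ∷ [])              _ () _
    sublist132⁻ (_ ∷ _ ∷ [])          _ () _
    sublist132⁻ (_ ∷ _ ∷ _ ∷ _ ∷ _)   _ () _

  contains132⁻ : ∀ σ → T (contains p1-3-2 σ) → Has132 σ
  contains132⁻ σ occ with find (any⁻ (λ s → orderIso s (1 ∷ 3 ∷ 2 ∷ [])) (sublists 3 σ) (subst T (contains132-sublists σ) occ))
  ... | s , s∈ , s~132 = let (s⊆ , len) = ∈-sublists⁻ 3 σ s∈ in sublist132⁻ s s⊆ len s~132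

  contains132⁺ : ∀ σ → Has132 σ → T (contains p1-3-2 σ)
  contains132⁺ σ (x , y , z , s⊆ , x<z , z<y) =
    subst T (sym (contains132-sublists σ))
      (any⁺ (λ s → orderIso s (1 ∷ 3 ∷ 2 ∷ [])) (lose (∈-sublists⁺ s⊆) (Equivalence.from T-≡ (matches-cong {x} {y} {z} {1} {3} {2} 1 3 2
        (sameOrder (<ᵇ-true (<-trans x<z z<y)) (<ᵇ-true x<z) (<ᵇ-false (<⇒≤ (<-trans x<z z<y)))
                   (<ᵇ-false (<⇒≤ z<y)) (<ᵇ-false (<⇒≤ x<z)) (<ᵇ-true z<y))))))

  Has132-⊆ : ∀ {s σ} → s ⊆ σ → Has132 s → Has132 σ
  Has132-⊆ s⊆σ (x , y , z , p , x<z , z<y) = x , y , z , ⊆-trans p s⊆σ , x<z , z<y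

  avoids132 : List ℕ → Bool
  avoids132 = avoids p1-3-2

  avoids132⁻ : ∀ {σ} → T (avoids132 σ) → ¬ Has132 σ
  avoids132⁻ {σ} av occ with contains p1-3-2 σ | contains132⁺ σ occ
  ... | true  | _ = av

  avoids132⁺ : ∀ {σ} → ¬ Has132 σ → T (avoids132 σ)
  avoids132⁺ {σ} ¬occ with contains p1-3-2 σ in eq
  ... | false = tt
  ... | true  = ¬occ (contains132⁻ σ (subst T (sym eq) tt))

  ⊆-++⁻ : ∀ {s : List ℕ} a {c} → s ⊆ a ++ c → ∃₂ λ s₁ s₂ → s ≡ s₁ ++ s₂ × s₁ ⊆ a × s₂ ⊆ c
  ⊆-++⁻ []      p          = [] , _ , refl , [] , p
  ⊆-++⁻ (x ∷ a) (refl ∷ p) with s₁ , s₂ , refl , p₁ , p₂ ← ⊆-++⁻ a p = x ∷ s₁ , s₂ , refl , refl ∷ p₁ , p₂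
  ⊆-++⁻ (x ∷ a) (.x ∷ʳ p)  with s₁ , s₂ , refl , p₁ , p₂ ← ⊆-++⁻ a p = s₁ , s₂ , refl , x ∷ʳ p₁ , p₂

  ⊆-map⁻ : ∀ (f : ℕ → ℕ) {s} a → s ⊆ map f a → ∃ λ s′ → s ≡ map f s′ × s′ ⊆ a
  ⊆-map⁻ f []      []         = [] , refl , []
  ⊆-map⁻ f (x ∷ a) (refl ∷ p) with s′ , refl , p′ ← ⊆-map⁻ f a p = x ∷ s′ , refl , refl ∷ p′
  ⊆-map⁻ f (x ∷ a) (_ ∷ʳ p)   with s′ , refl , p′ ← ⊆-map⁻ f a p = s′ , refl , x ∷ʳ p′

  Has132-raise⁻ : ∀ j α → Has132 (raise j α) → Has132 α
  Has132-raise⁻ j α (x , y , z , p , x<z , z<y) with ⊆-map⁻ (_+ j) α p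
  ... | x′ ∷ y′ ∷ z′ ∷ [] , refl , p′ = x′ , y′ , z′ , p′ , +-cancelʳ-< j x′ z′ x<z , +-cancelʳ-< j z′ y′ z<y

  Has132-raise⁺ : ∀ j α → Has132 α → Has132 (raise j α)
  Has132-raise⁺ j α (x , y , z , p , x<z , z<y) =
    x + j , y + j , z + j , Sublist.map⁺ (_+ j) p , +-monoˡ-< j x<z , +-monoˡ-< j z<y

module Decomposition where

  open import Defs using (perms)
  open Permutations
  open Pattern132
  open import Data.Nat using (ℕ; zero; suc; _+_; _*_; _∸_; _≤_; _<_; s≤s)
  open import Data.Nat.Properties
  open import Data.Bool using (Bool; true; false; T; T?; _∧_; if_then_else_)
  open import Data.List using (List; []; _∷_; _++_; map; concatMap; length; filterᵇ)
  open import Data.Nat.ListAction using (sum)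
  open NatConvolution using (csum)
  open Counting
  import Data.List.Relation.Unary.Unique.Propositional.Properties as Unique
  open import Data.List.Relation.Unary.Unique.Propositional using (Unique)
  open import Data.List.Relation.Unary.AllPairs using ([]; _∷_)
  open import Data.List.Properties
    using (length-map; length-++; length-applyDownFrom; map-∘; map-cong; map-cong-local; map-id; map-id-local; map-injective)
  open import Data.List.Relation.Unary.All as All using ([])
  open import Data.List.Membership.Propositional using (_∈_; _∉_; find; lose)
  open import Data.List.Membership.Propositional.Properties
    using (∈-map⁻; ∈-map⁺; ∈-++⁺ʳ; ∈-∃++; ∈-filter⁻; ∈-filter⁺; ∈-concatMap⁻; ∈-concatMap⁺)
  open import Data.List.Relation.Binary.Permutation.Propositional using (_↭_; ↭-refl; ↭-sym; ↭-trans; prep)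
  open import Data.List.Relation.Binary.Permutation.Propositional.Properties
    using (∈-resp-↭; ↭-length; shift; drop-mid; ++⁺; map⁺)
  open import Data.List.Relation.Binary.Sublist.Propositional using (_⊆_; []; _∷_; _∷ʳ_; from∈; ⊆-refl)
  open import Data.List.Relation.Binary.Sublist.Propositional.Properties using (Any-resp-⊆; ++⁺ˡ; ++⁺ʳ)
  import Data.List.Relation.Binary.Sublist.Propositional.Properties as Sublist
  open import Data.List.Relation.Unary.Any using (here; there)
  open import Data.Product using (∃₂; _×_; _,_; proj₁; proj₂; map₁; uncurry)
  open import Data.Empty using (⊥-elim)
  open import Relation.Nullary using (¬_)
  open import Function using (_∘_; _$_; _⟨_⟩_; case_of_; mk⇔; Equivalence)
  open import Data.Bool.Properties using (T-∧)
  open import Relation.Binary.Definitions using (tri<; tri≈; tri>)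
  open import Relation.Binary.PropositionalEquality

  glue : List ℕ → List ℕ → List ℕ
  glue α β = raise (length β) α ++ suc (length α + length β) ∷ β

  glue-≡ : ∀ {i j α β} → IsPerm i α → IsPerm j β → glue α β ≡ raise j α ++ suc (i + j) ∷ β
  glue-≡ {α = α} {β} α↭ β↭ rewrite perm-length α↭ | perm-length β↭ = refl

  glue-perm : ∀ {i j α β} → IsPerm i α → IsPerm j β → IsPerm (suc (i + j)) (glue α β)
  glue-perm {i} {j} {α} {β} α↭ β↭ = subst (λ σ → IsPerm (suc (i + j)) σ) (sym (glue-≡ α↭ β↭)) $
    ↭-trans (shift (suc (i + j)) (raise j α) β)
            (prep (suc (i + j)) (subst (raise j α ++ β ↭_) (sym (values-+ i j)) (++⁺ (map⁺ (_+ j) α↭) β↭)))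

  private
    second∈ : ∀ {u v m : ℕ} {β} → (u ∷ v ∷ []) ⊆ m ∷ β → v ∈ β
    second∈ (refl ∷ p) = Any-resp-⊆ p (here refl)
    second∈ (_ ∷ʳ p)   = Any-resp-⊆ p (there (here refl))

  -- An occurrence of 132 cannot straddle the blocks: raise j α lies above β, and suc (i + j) above both.
  glue-avoids132 : ∀ {i j α β} → IsPerm i α → IsPerm j β →
                   T (avoids132 α) → T (avoids132 β) → T (avoids132 (glue α β))
  glue-avoids132 {i} {j} {α} {β} α↭ β↭ avα avβ =
    subst (T ∘ avoids132) (sym (glue-≡ α↭ β↭)) (avoids132⁺ no132)
    where
    β≤j : ∀ {y} → y ∈ β → y ≤ j
    β≤j = proj₂ ∘ ∈-perm⁻ β↭
    no132 : ¬ Has132 (raise j α ++ suc (i + j) ∷ β)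
    no132 (x , y , z , p , x<z , z<y) with ⊆-++⁻ (raise j α) p
    ... | [] , _ , refl , _ , refl ∷ q =
      <-asym (n<1+n (i + j)) (<-≤-trans x<z (≤-trans (β≤j (Any-resp-⊆ q (there (here refl)))) (m≤n+m j i)))
    ... | [] , _ , refl , _ , _ ∷ʳ q = avoids132⁻ avβ (x , y , z , q , x<z , z<y)
    ... | _ ∷ [] , _ , refl , p₁ , q =
      <-asym (proj₁ (∈-raise⁻ α↭ (Any-resp-⊆ p₁ (here refl)))) (<-≤-trans x<z (β≤j (second∈ q)))
    ... | _ ∷ _ ∷ [] , _ , refl , p₁ , refl ∷ _ =
      <-asym (s≤s (proj₂ (∈-raise⁻ α↭ (Any-resp-⊆ p₁ (there (here refl)))))) z<y
    ... | _ ∷ _ ∷ [] , _ , refl , p₁ , _ ∷ʳ q =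
      <-asym (proj₁ (∈-raise⁻ α↭ (Any-resp-⊆ p₁ (here refl)))) (<-≤-trans x<z (β≤j (Any-resp-⊆ q (here refl))))
    ... | _ ∷ _ ∷ _ ∷ [] , [] , refl , p₁ , _ = avoids132⁻ avα (Has132-raise⁻ j α (x , y , z , p₁ , x<z , z<y))

  record Glued (n : ℕ) (σ : List ℕ) : Set where
    constructor glued
    field
      α β      : List ℕ
      α-perm   : IsPerm (length α) α
      β-perm   : IsPerm (length β) β
      α-avoids : T (avoids132 α)
      β-avoids : T (avoids132 β)
      size     : n ≡ length α + length β
      σ≡glue   : σ ≡ glue α β

  -- 132-avoidance forces every entry left of the maximum to exceed every entry right of it.
  decompose : ∀ {n σ} → IsPerm (suc n) σ → T (avoids132 σ) → Glued n σ
  decompose {n} σ↭ avσ with ∈-∃++ (∈-resp-↭ (↭-sym σ↭) (here refl))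
  ... | a , b , refl = glued α b α↭ b↭ avα avb size (cong (_++ suc n ∷ b) (sym raise-α) ⟨ trans ⟩ cong (λ k → a′ ++ suc k ∷ b) size)
    where
    ab↭ : a ++ b ↭ values n
    ab↭ = drop-mid a [] σ↭
    b<a : ∀ {x y} → x ∈ a → y ∈ b → y < x
    b<a {x} {y} x∈a y∈b with <-cmp x y
    ... | tri< x<y _ _ = ⊥-elim (avoids132⁻ avσ
          (x , suc n , y , Sublist.++⁺ (from∈ x∈a) (refl ∷ from∈ y∈b) , x<y , s≤s (proj₂ (∈-perm⁻ ab↭ (∈-++⁺ʳ a y∈b)))))
    ... | tri≈ _ refl _ = ⊥-elim (unique-++-disjoint a (perm-unique ab↭) x∈a y∈b)
    ... | tri> _ _ y<x = y<x
    j = length b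
    i = length a
    b↭ : IsPerm j b
    b↭ = proj₁ (split-values n a b ab↭ b<a)
    a↭ : a ↭ raise j (values i)
    a↭ = proj₂ (split-values n a b ab↭ b<a)
    α = map (_∸ j) a
    a′ = raise j α
    raise-α : a′ ≡ a
    raise-α = trans (sym (map-∘ a))
                    (map-id-local (All.tabulate λ x∈ → m∸n+n≡m (<⇒≤ (proj₁ (∈-raise⁻ {i} ↭-refl (∈-resp-↭ a↭ x∈))))))
    α↭ : IsPerm (length α) α
    α↭ = subst (λ k → α ↭ values k) (sym (length-map (_∸ j) a))
               (subst (α ↭_) (trans (sym (map-∘ (values i))) (trans (map-cong (λ x → m+n∸n≡m x j) (values i)) (map-id (values i))))
                      (map⁺ (_∸ j) a↭))
    avα : T (avoids132 α)
    avα = avoids132⁺ λ occ → avoids132⁻ avσ (Has132-⊆ (subst (_⊆ a ++ suc n ∷ b) (sym raise-α) (++⁺ʳ (suc n ∷ b) ⊆-refl))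
                                                     (Has132-raise⁺ j α occ))
    avb : T (avoids132 b)
    avb = avoids132⁺ λ occ → avoids132⁻ avσ (Has132-⊆ (++⁺ˡ a (suc n ∷ʳ ⊆-refl)) occ)
    size : n ≡ length α + j
    size = trans (sym (length-applyDownFrom suc n))
                 (trans (sym (↭-length ab↭)) (trans (length-++ a) (cong (_+ j) (sym (length-map (_∸ j) a)))))

  glue-injective : ∀ {i j i′ j′ α β α′ β′} → IsPerm i α → IsPerm j β → IsPerm i′ α′ → IsPerm j′ β′ →
                   glue α β ≡ glue α′ β′ → α ≡ α′ × β ≡ β′
  glue-injective {i} {j} {i′} {j′} {α} {β} {α′} {β′} α↭ β↭ α′↭ β′↭ eq
    with ++-∷-injective (raise j α) (raise j′ α′) (max∉ α↭) (subst (λ k → suc k ∉ raise j′ α′) (sym sizes) (max∉ α′↭))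
           (trans (sym (glue-≡ α↭ β↭)) (trans eq (trans (glue-≡ α′↭ β′↭) (cong (λ k → raise j′ α′ ++ suc k ∷ β′) (sym sizes)))))
    where
    max∉ : ∀ {i j α} → IsPerm i α → suc (i + j) ∉ raise j α
    max∉ α↭ m∈ = <-irrefl refl (s≤s (proj₂ (∈-raise⁻ α↭ m∈)))
    sizes : i + j ≡ i′ + j′
    sizes = suc-injective (trans (sym (perm-length (glue-perm α↭ β↭))) (trans (cong length eq) (perm-length (glue-perm α′↭ β′↭))))
  ... | raise≡ , refl with trans (sym (perm-length β↭)) (perm-length β′↭)
  ... | refl = map-injective (+-cancelʳ-≡ j _ _) raise≡ , refl

  avoiders : ℕ → List (List ℕ)
  avoiders k = filterᵇ avoids132 (perms k)

  ∈-avoiders⁻ : ∀ k {σ} → σ ∈ avoiders k → IsPerm k σ × T (avoids132 σ)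
  ∈-avoiders⁻ k σ∈ with σ∈perms , avσ ← ∈-filter⁻ (T? ∘ avoids132) {xs = perms k} σ∈ = perms-sound k σ∈perms , avσ

  ∈-avoiders⁺ : ∀ {k σ} → IsPerm k σ → T (avoids132 σ) → σ ∈ avoiders k
  ∈-avoiders⁺ {k} σ↭ avσ = ∈-filter⁺ (T? ∘ avoids132) (perms-complete k σ↭) avσ

  avoiders-unique : ∀ k → Unique (avoiders k)
  avoiders-unique k = Unique.filter⁺ (T? ∘ avoids132) (perms-unique k)

  splits : ℕ → List (ℕ × ℕ)
  splits zero    = (0 , 0) ∷ []
  splits (suc n) = (0 , suc n) ∷ map (map₁ suc) (splits n)

  ∈-splits⁻ : ∀ {n i j} → (i , j) ∈ splits n → i + j ≡ n
  ∈-splits⁻ {zero}  (here refl) = refl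
  ∈-splits⁻ {suc n} (here refl) = refl
  ∈-splits⁻ {suc n} (there ij∈) with ∈-map⁻ (map₁ suc) ij∈
  ... | (i , j) , ij∈′ , refl = cong suc (∈-splits⁻ ij∈′)

  ∈-splits⁺ : ∀ i j → (i , j) ∈ splits (i + j)
  ∈-splits⁺ zero    zero    = here refl
  ∈-splits⁺ zero    (suc j) = here refl
  ∈-splits⁺ (suc i) j       = there (∈-map⁺ (map₁ suc) (∈-splits⁺ i j))

  splits-unique : ∀ n → Unique (splits n)
  splits-unique zero    = [] ∷ []
  splits-unique (suc n) =
    All.tabulate (λ ij∈ eq → case ∈-map⁻ (map₁ suc) ij∈ of λ { (_ , _ , refl) → 0≢1+n (cong proj₁ eq) })
    ∷ Unique.map⁺ (λ eq → cong₂ _,_ (suc-injective (cong proj₁ eq)) (cong proj₂ eq)) (splits-unique n)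

  sum-splits : ∀ G n → sum (map (uncurry G) (splits n)) ≡ csum G n
  sum-splits G zero    = +-identityʳ (G 0 0)
  sum-splits G (suc n) = cong (G 0 (suc n) +_) (trans (cong sum (sym (map-∘ (splits n)))) (sum-splits (λ i j → G (suc i) j) n))

  gluings : ℕ → ℕ → List (List ℕ)
  gluings i j = concatMap (λ α → map (glue α) (avoiders j)) (avoiders i)

  glueds : ℕ → List (List ℕ)
  glueds n = concatMap (uncurry gluings) (splits n)

  ∈-gluings⁻ : ∀ {i j σ} → σ ∈ gluings i j →
    ∃₂ λ α β → α ∈ avoiders i × β ∈ avoiders j × σ ≡ glue α β
  ∈-gluings⁻ {i} {j} σ∈ with α , α∈ , σ∈′ ← find (∈-concatMap⁻ (λ α → map (glue α) (avoiders j)) {xs = avoiders i} σ∈)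
                        with β , β∈ , refl ← ∈-map⁻ (glue α) σ∈′ = α , β , α∈ , β∈ , refl

  ∈-glueds⁻ : ∀ {n σ} → σ ∈ glueds n → IsPerm (suc n) σ × T (avoids132 σ)
  ∈-glueds⁻ {n} σ∈ with (i , j) , ij∈ , σ∈′ ← find (∈-concatMap⁻ (uncurry gluings) {xs = splits n} σ∈)
                   with α , β , α∈ , β∈ , refl ← ∈-gluings⁻ {i} {j} σ∈′
                   with α↭ , avα ← ∈-avoiders⁻ i α∈
                   with β↭ , avβ ← ∈-avoiders⁻ j β∈
    = subst (λ k → IsPerm (suc k) (glue α β)) (∈-splits⁻ ij∈) (glue-perm α↭ β↭) , glue-avoids132 α↭ β↭ avα avβ

  ∈-glueds⁺ : ∀ {n σ} → IsPerm (suc n) σ → T (avoids132 σ) → σ ∈ glueds n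
  ∈-glueds⁺ σ↭ avσ with decompose σ↭ avσ
  ... | glued α β α↭ β↭ avα avβ refl refl =
    ∈-concatMap⁺ (uncurry gluings) (lose (∈-splits⁺ (length α) (length β))
      (∈-concatMap⁺ (λ α → map (glue α) (avoiders (length β))) (lose (∈-avoiders⁺ α↭ avα)
        (∈-map⁺ (glue α) (∈-avoiders⁺ β↭ avβ)))))

  glueds-unique : ∀ n → Unique (glueds n)
  glueds-unique n = concatMap-unique (splits-unique n) (λ {ij} _ → gluings-unique (proj₁ ij) (proj₂ ij)) splits-disjoint
    where
    glue-injective′ : ∀ i j i′ j′ {α β α′ β′} → α ∈ avoiders i → β ∈ avoiders j → α′ ∈ avoiders i′ → β′ ∈ avoiders j′ →
                      glue α β ≡ glue α′ β′ → α ≡ α′ × β ≡ β′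
    glue-injective′ i j i′ j′ α∈ β∈ α′∈ β′∈ = glue-injective (proj₁ (∈-avoiders⁻ i α∈)) (proj₁ (∈-avoiders⁻ j β∈))
                                                             (proj₁ (∈-avoiders⁻ i′ α′∈)) (proj₁ (∈-avoiders⁻ j′ β′∈))
    gluings-unique : ∀ i j → Unique (gluings i j)
    gluings-unique i j = concatMap-unique (avoiders-unique i)
      (λ α∈ → map-unique (avoiders-unique j) (λ β∈ β′∈ → proj₂ ∘ glue-injective′ i j i j α∈ β∈ α∈ β′∈))
      (λ α∈ α′∈ σ∈ σ∈′ → case ∈-map⁻ _ σ∈ , ∈-map⁻ _ σ∈′ of λ where
        ((β , β∈ , refl) , (β′ , β′∈ , eq)) → proj₁ (glue-injective′ i j i j α∈ β∈ α′∈ β′∈ eq))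
    splits-disjoint : ∀ {ij ij′ σ} → ij ∈ splits n → ij′ ∈ splits n →
                      σ ∈ uncurry gluings ij → σ ∈ uncurry gluings ij′ → ij ≡ ij′
    splits-disjoint {i , j} {i′ , j′} _ _ σ∈ σ∈′
      with α , β , α∈ , β∈ , refl ← ∈-gluings⁻ {i} {j} σ∈
      with α′ , β′ , α′∈ , β′∈ , eq ← ∈-gluings⁻ {i′} {j′} σ∈′
      with refl , refl ← glue-injective′ i j i′ j′ α∈ β∈ α′∈ β′∈ eq
      = cong₂ _,_ (trans (sym (perm-length (proj₁ (∈-avoiders⁻ i α∈)))) (perm-length (proj₁ (∈-avoiders⁻ i′ α′∈))))
                  (trans (sym (perm-length (proj₁ (∈-avoiders⁻ j β∈)))) (perm-length (proj₁ (∈-avoiders⁻ j′ β′∈))))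

  count132 : (List ℕ → Bool) → ℕ → ℕ
  count132 q k = count (λ σ → avoids132 σ ∧ q σ) (perms k)

  Multiplicative : (q q₁ q₂ : List ℕ → Bool) → (ℕ → ℕ → Bool) → Set
  Multiplicative q q₁ q₂ c = ∀ {i j α β} → IsPerm i α → IsPerm j β → T (avoids132 α) → T (avoids132 β) →
                             q (glue α β) ≡ (c i j ∧ q₁ α) ∧ q₂ β

  count132-suc : ∀ {q q₁ q₂ c} → Multiplicative q q₁ q₂ c → ∀ n →
    count132 q (suc n) ≡ csum (λ i j → if c i j then count132 q₁ i * count132 q₂ j else 0) n
  count132-suc {q} {q₁} {q₂} {c} mult n = begin
    count132 q (suc n)
      ≡⟨ count-unique-bijection (perms-unique (suc n)) (glueds-unique n) (mk⇔ to from) ⟩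
    count q (glueds n)
      ≡⟨ count-concatMap q (uncurry gluings) (splits n) ⟩
    sum (map (count q ∘ uncurry gluings) (splits n))
      ≡⟨ cong sum (map-cong (uncurry count-gluings) (splits n)) ⟩
    sum (map (uncurry G) (splits n))
      ≡⟨ sum-splits G n ⟩
    csum G n ∎
    where
    open ≡-Reasoning
    G : ℕ → ℕ → ℕ
    G i j = if c i j then count132 q₁ i * count132 q₂ j else 0
    to : ∀ {σ} → σ ∈ perms (suc n) × T (avoids132 σ ∧ q σ) → σ ∈ glueds n × T (q σ)
    to (σ∈ , avq) = let (avσ , qσ) = Equivalence.to T-∧ avq in ∈-glueds⁺ (perms-sound (suc n) σ∈) avσ , qσ
    from : ∀ {σ} → σ ∈ glueds n × T (q σ) → σ ∈ perms (suc n) × T (avoids132 σ ∧ q σ)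
    from (σ∈ , qσ) = let (σ↭ , avσ) = ∈-glueds⁻ σ∈ in perms-complete (suc n) σ↭ , Equivalence.from T-∧ (avσ , qσ)
    scaled : ∀ b {p} (xs : List (List ℕ)) K → count (λ x → b ∧ p x) xs * K ≡ (if b then count p xs * K else 0)
    scaled true  xs K = refl
    scaled false xs K = cong (_* K) (count-false xs)
    count-gluings : ∀ i j → count q (gluings i j) ≡ G i j
    count-gluings i j = begin
      count q (gluings i j)
        ≡⟨ count-concatMap q (λ α → map (glue α) (avoiders j)) (avoiders i) ⟩
      sum (map (λ α → count q (map (glue α) (avoiders j))) (avoiders i))
        ≡⟨ cong sum (map-cong-local (All.tabulate λ α∈ → trans (count-map q (glue _) (avoiders j))
             (count-cong (avoiders j) λ β∈ → let (α↭ , avα) = ∈-avoiders⁻ i α∈ ; (β↭ , avβ) = ∈-avoiders⁻ j β∈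
                                               in mult α↭ β↭ avα avβ))) ⟩
      sum (map (λ α → count (λ β → (c i j ∧ q₁ α) ∧ q₂ β) (avoiders j)) (avoiders i))
        ≡⟨ sum-count-∧ (λ α → c i j ∧ q₁ α) q₂ (avoiders i) (avoiders j) ⟩
      count (λ α → c i j ∧ q₁ α) (avoiders i) * count q₂ (avoiders j)
        ≡⟨ scaled (c i j) (avoiders i) (count q₂ (avoiders j)) ⟩
      (if c i j then count q₁ (avoiders i) * count q₂ (avoiders j) else 0)
        ≡⟨ cong₂ (λ a b → if c i j then a * b else 0) (count-filterᵇ avoids132 q₁ (perms i)) (count-filterᵇ avoids132 q₂ (perms j)) ⟩
      G i j ∎

module GlueWindows where

  open Permutations using (IsPerm; raise; ∈-perm⁻; ∈-raise⁻)
  open TriplePatterns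
  open Decomposition using (glue; glue-≡)
  open import Data.Nat using (ℕ; suc; _+_; _≤_; _<_; s≤s; _<ᵇ_)
  open import Data.Nat.Properties using (<⇒≤; <-trans; <-cmp; ≤-trans; ≤-<-trans; m≤n+m)
  open import Data.Bool using (Bool; true; false; _∧_; _∨_; if_then_else_)
  open import Data.Bool.Properties using (∨-identityʳ; ∨-assoc)
  open import Data.List using (List; []; _∷_; _++_)
  open import Data.List.Membership.Propositional using (_∈_)
  open import Data.List.Relation.Unary.Any using (here; there)
  open import Data.Product using (proj₁; proj₂)
  open import Function using (_∘_)
  open import Data.List.Relation.Binary.Permutation.Propositional using (↭-refl)
  open import Data.List using (length)
  open import Relation.Binary.Definitions using (tri<; tri≈; tri>)
  open import Relation.Binary.PropositionalEquality

  nonEmpty : List ℕ → Bool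
  nonEmpty []      = false
  nonEmpty (_ ∷ _) = true

  lastPair : (Bool → Bool → Bool) → List ℕ → Bool
  lastPair F (x ∷ y ∷ [])    = F (x <ᵇ y) (y <ᵇ x)
  lastPair F (x ∷ y ∷ z ∷ r) = lastPair F (y ∷ z ∷ r)
  lastPair F _               = false

  firstPair : (Bool → Bool → Bool) → List ℕ → Bool
  firstPair F (x ∷ y ∷ _) = F (x <ᵇ y) (y <ᵇ x)
  firstPair F _           = false

  -- The shape of a window x y m (resp. m y z) whose m exceeds the other two entries depends only on how those compare.
  belowMax aboveMax : ℕ → ℕ → ℕ → Bool → Bool → Bool
  belowMax a b c x<y y<x = if x<y then matches a b c 0 1 2 else if y<x then matches a b c 1 0 2 else matches a b c 0 0 2
  aboveMax a b c y<z z<y = if y<z then matches a b c 2 0 1 else if z<y then matches a b c 2 1 0 else matches a b c 2 0 0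

  three-way-false : ∀ {p q r : Bool} → p ≡ false → q ≡ false → r ≡ false →
                    ∀ t s → (if t then p else if s then q else r) ≡ false
  three-way-false p≡ q≡ r≡ true  _     = p≡
  three-way-false p≡ q≡ r≡ false true  = q≡
  three-way-false p≡ q≡ r≡ false false = r≡

  matches-belowMax : ∀ a b c {x y m} → x < m → y < m → matches a b c x y m ≡ belowMax a b c (x <ᵇ y) (y <ᵇ x)
  matches-belowMax a b c {x} {y} {m} x<m y<m with <-cmp x y
  ... | tri< x<y _ _ = trans
    (matches-cong {x} {y} {m} {0} {1} {2} a b c (sameOrder (<ᵇ-true x<y) (<ᵇ-true x<m) (<ᵇ-false (<⇒≤ x<y))
                                                          (<ᵇ-true y<m) (<ᵇ-false (<⇒≤ x<m)) (<ᵇ-false (<⇒≤ y<m))))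
    (cong (λ t → belowMax a b c t (y <ᵇ x)) (sym (<ᵇ-true x<y)))
  ... | tri≈ _ refl _ = trans
    (matches-cong {x} {x} {m} {0} {0} {2} a b c (sameOrder (<ᵇ-irrefl x) (<ᵇ-true x<m) (<ᵇ-irrefl x)
                                                          (<ᵇ-true x<m) (<ᵇ-false (<⇒≤ x<m)) (<ᵇ-false (<⇒≤ x<m))))
    (cong₂ (belowMax a b c) (sym (<ᵇ-irrefl x)) (sym (<ᵇ-irrefl x)))
  ... | tri> _ _ y<x = trans
    (matches-cong {x} {y} {m} {1} {0} {2} a b c (sameOrder (<ᵇ-false (<⇒≤ y<x)) (<ᵇ-true x<m) (<ᵇ-true y<x)
                                                          (<ᵇ-true y<m) (<ᵇ-false (<⇒≤ x<m)) (<ᵇ-false (<⇒≤ y<m))))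
    (cong₂ (belowMax a b c) (sym (<ᵇ-false (<⇒≤ y<x))) (sym (<ᵇ-true y<x)))

  matches-aroundMax : ∀ a b c {x y m} → y < x → x < m → matches a b c x m y ≡ matches a b c 1 2 0
  matches-aroundMax a b c {x} {y} {m} y<x x<m = matches-cong {x} {m} {y} {1} {2} {0} a b c
    (sameOrder (<ᵇ-true x<m) (<ᵇ-false (<⇒≤ y<x)) (<ᵇ-false (<⇒≤ x<m)) (<ᵇ-false (<⇒≤ (<-trans y<x x<m)))
               (<ᵇ-true y<x) (<ᵇ-true (<-trans y<x x<m)))

  matches-aboveMax : ∀ a b c {m y z} → y < m → z < m → matches a b c m y z ≡ aboveMax a b c (y <ᵇ z) (z <ᵇ y)
  matches-aboveMax a b c {m} {y} {z} y<m z<m with <-cmp y z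
  ... | tri< y<z _ _ = trans
    (matches-cong {m} {y} {z} {2} {0} {1} a b c (sameOrder (<ᵇ-false (<⇒≤ y<m)) (<ᵇ-false (<⇒≤ z<m)) (<ᵇ-true y<m)
                                                          (<ᵇ-true y<z) (<ᵇ-true z<m) (<ᵇ-false (<⇒≤ y<z))))
    (cong (λ t → aboveMax a b c t (z <ᵇ y)) (sym (<ᵇ-true y<z)))
  ... | tri≈ _ refl _ = trans
    (matches-cong {m} {y} {y} {2} {0} {0} a b c (sameOrder (<ᵇ-false (<⇒≤ y<m)) (<ᵇ-false (<⇒≤ y<m)) (<ᵇ-true y<m)
                                                          (<ᵇ-irrefl y) (<ᵇ-true y<m) (<ᵇ-irrefl y)))
    (cong₂ (aboveMax a b c) (sym (<ᵇ-irrefl y)) (sym (<ᵇ-irrefl y)))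
  ... | tri> _ _ z<y = trans
    (matches-cong {m} {y} {z} {2} {1} {0} a b c (sameOrder (<ᵇ-false (<⇒≤ y<m)) (<ᵇ-false (<⇒≤ z<m)) (<ᵇ-true y<m)
                                                          (<ᵇ-false (<⇒≤ z<y)) (<ᵇ-true z<m) (<ᵇ-true z<y)))
    (cong₂ (aboveMax a b c) (sym (<ᵇ-false (<⇒≤ z<y))) (sym (<ᵇ-true z<y)))

  windowsInto : (ℕ → ℕ → ℕ → Bool) → List ℕ → ℕ → List ℕ → Bool
  windowsInto P []                 m ys      = false
  windowsInto P (x ∷ [])           m []      = false
  windowsInto P (x ∷ [])           m (y ∷ _) = P x m y
  windowsInto P (x₁ ∷ x₂ ∷ [])     m ys      = P x₁ x₂ m ∨ windowsInto P (x₂ ∷ []) m ys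
  windowsInto P (x₁ ∷ x₂ ∷ x₃ ∷ r) m ys      = windowsInto P (x₂ ∷ x₃ ∷ r) m ys

  windowFrom : (ℕ → ℕ → ℕ → Bool) → ℕ → List ℕ → Bool
  windowFrom P m (y ∷ z ∷ _) = P m y z
  windowFrom P m _           = false

  private
    anyWindow-∷ : ∀ P m ys → anyWindow P (m ∷ ys) ≡ windowFrom P m ys ∨ anyWindow P ys
    anyWindow-∷ P m []          = refl
    anyWindow-∷ P m (y ∷ [])    = refl
    anyWindow-∷ P m (y ∷ z ∷ r) = refl

  anyWindow-++-∷ : ∀ P xs m ys → anyWindow P (xs ++ m ∷ ys) ≡
                   (anyWindow P xs ∨ windowsInto P xs m ys) ∨ (windowFrom P m ys ∨ anyWindow P ys)
  anyWindow-++-∷ P []                 m ys       = anyWindow-∷ P m ys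
  anyWindow-++-∷ P (x ∷ [])           m []       = refl
  anyWindow-++-∷ P (x ∷ [])           m (y ∷ ys) = cong (P x m y ∨_) (anyWindow-∷ P m (y ∷ ys))
  anyWindow-++-∷ P (x₁ ∷ x₂ ∷ [])     m []       = sym (∨-identityʳ (P x₁ x₂ m ∨ false))
  anyWindow-++-∷ P (x₁ ∷ x₂ ∷ [])     m (y ∷ ys) =
    trans (cong (λ b → P x₁ x₂ m ∨ (P x₂ m y ∨ b)) (anyWindow-∷ P m (y ∷ ys)))
          (sym (∨-assoc (P x₁ x₂ m) (P x₂ m y) _))
  anyWindow-++-∷ P (x₁ ∷ x₂ ∷ x₃ ∷ r) m ys       =
    trans (cong (P x₁ x₂ x₃ ∨_) (anyWindow-++-∷ P (x₂ ∷ x₃ ∷ r) m ys))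
          (trans (sym (∨-assoc (P x₁ x₂ x₃) _ _))
                 (cong (_∨ (windowFrom P m ys ∨ anyWindow P ys)) (sym (∨-assoc (P x₁ x₂ x₃) _ _))))

  anyWindow-raise : ∀ a b c j α → anyWindow (matches a b c) (raise j α) ≡ anyWindow (matches a b c) α
  anyWindow-raise a b c j []              = refl
  anyWindow-raise a b c j (x ∷ [])        = refl
  anyWindow-raise a b c j (x ∷ y ∷ [])    = refl
  anyWindow-raise a b c j (x ∷ y ∷ z ∷ r) = cong₂ _∨_ (matches-+ʳ a b c x y z j) (anyWindow-raise a b c j (y ∷ z ∷ r))

  lastPair-raise : ∀ F j α → lastPair F (raise j α) ≡ lastPair F α
  lastPair-raise F j []              = refl
  lastPair-raise F j (x ∷ [])        = refl
  lastPair-raise F j (x ∷ y ∷ [])    = cong₂ F (<ᵇ-+ʳ x y j) (<ᵇ-+ʳ y x j)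
  lastPair-raise F j (x ∷ y ∷ z ∷ r) = lastPair-raise F j (y ∷ z ∷ r)

  firstPair-raise : ∀ F j α → firstPair F (raise j α) ≡ firstPair F α
  firstPair-raise F j []          = refl
  firstPair-raise F j (x ∷ [])    = refl
  firstPair-raise F j (x ∷ y ∷ r) = cong₂ F (<ᵇ-+ʳ x y j) (<ᵇ-+ʳ y x j)

  windowsInto-eval : ∀ P F (across : Bool) m xs ys →
    (∀ {x y} → x ∈ xs → y ∈ xs → P x y m ≡ F (x <ᵇ y) (y <ᵇ x)) →
    (∀ {x y} → x ∈ xs → y ∈ ys → P x m y ≡ across) →
    windowsInto P xs m ys ≡ lastPair F xs ∨ ((nonEmpty xs ∧ nonEmpty ys) ∧ across)
  windowsInto-eval P F across m []                 ys       below around = refl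
  windowsInto-eval P F across m (x ∷ [])           []       below around = refl
  windowsInto-eval P F across m (x ∷ [])           (y ∷ ys) below around = around (here refl) (here refl)
  windowsInto-eval P F across m (x₁ ∷ x₂ ∷ [])     []       below around =
    trans (∨-identityʳ _) (trans (below (here refl) (there (here refl))) (sym (∨-identityʳ _)))
  windowsInto-eval P F across m (x₁ ∷ x₂ ∷ [])     (y ∷ ys) below around =
    cong₂ _∨_ (below (here refl) (there (here refl))) (around (there (here refl)) (here refl))
  windowsInto-eval P F across m (x₁ ∷ x₂ ∷ x₃ ∷ r) ys       below around =
    windowsInto-eval P F across m (x₂ ∷ x₃ ∷ r) ys (λ p q → below (there p) (there q)) (λ p q → around (there p) q)

  windowFrom-eval : ∀ P G m ys → (∀ {y z} → y ∈ ys → z ∈ ys → P m y z ≡ G (y <ᵇ z) (z <ᵇ y)) →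
                    windowFrom P m ys ≡ firstPair G ys
  windowFrom-eval P G m []          above = refl
  windowFrom-eval P G m (y ∷ [])    above = refl
  windowFrom-eval P G m (y ∷ z ∷ r) above = above (here refl) (there (here refl))

  nonEmpty-raise : ∀ j α → nonEmpty (raise j α) ≡ nonEmpty α
  nonEmpty-raise j []      = refl
  nonEmpty-raise j (_ ∷ _) = refl

  module _ {i j α β} (α↭ : IsPerm i α) (β↭ : IsPerm j β) where

    private
      left<max : ∀ {x} → x ∈ raise j α → x < suc (i + j)
      left<max x∈ = s≤s (proj₂ (∈-raise⁻ α↭ x∈))

      right<left : ∀ {x y} → x ∈ raise j α → y ∈ β → y < x
      right<left x∈ y∈ = ≤-<-trans (proj₂ (∈-perm⁻ β↭ y∈)) (proj₁ (∈-raise⁻ α↭ x∈))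

      right<max : ∀ {y} → y ∈ β → y < suc (i + j)
      right<max y∈ = s≤s (≤-trans (proj₂ (∈-perm⁻ β↭ y∈)) (m≤n+m j i))

    anyWindow-glue : ∀ a b c → anyWindow (matches a b c) (glue α β) ≡
      (anyWindow (matches a b c) α ∨ (lastPair (belowMax a b c) α ∨ ((nonEmpty α ∧ nonEmpty β) ∧ matches a b c 1 2 0)))
      ∨ (firstPair (aboveMax a b c) β ∨ anyWindow (matches a b c) β)
    anyWindow-glue a b c = begin
      anyWindow P (glue α β)
        ≡⟨ cong (anyWindow P) (glue-≡ α↭ β↭) ⟩
      anyWindow P (raise j α ++ suc (i + j) ∷ β)
        ≡⟨ anyWindow-++-∷ P (raise j α) (suc (i + j)) β ⟩
      (anyWindow P (raise j α) ∨ windowsInto P (raise j α) (suc (i + j)) β) ∨ (windowFrom P (suc (i + j)) β ∨ anyWindow P β)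
        ≡⟨ cong₂ (λ u v → (u ∨ v) ∨ (windowFrom P (suc (i + j)) β ∨ anyWindow P β)) (anyWindow-raise a b c j α) into ⟩
      (anyWindow P α ∨ (lastPair (belowMax a b c) α ∨ ((nonEmpty α ∧ nonEmpty β) ∧ matches a b c 1 2 0)))
        ∨ (windowFrom P (suc (i + j)) β ∨ anyWindow P β)
        ≡⟨ cong (λ u → (anyWindow P α ∨ (lastPair (belowMax a b c) α ∨ ((nonEmpty α ∧ nonEmpty β) ∧ P 1 2 0))) ∨ (u ∨ anyWindow P β))
                (windowFrom-eval P (aboveMax a b c) (suc (i + j)) β λ y∈ z∈ → matches-aboveMax a b c (right<max y∈) (right<max z∈)) ⟩
      (anyWindow P α ∨ (lastPair (belowMax a b c) α ∨ ((nonEmpty α ∧ nonEmpty β) ∧ matches a b c 1 2 0)))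
        ∨ (firstPair (aboveMax a b c) β ∨ anyWindow P β) ∎
      where
      open ≡-Reasoning
      P = matches a b c
      into : windowsInto P (raise j α) (suc (i + j)) β ≡ lastPair (belowMax a b c) α ∨ ((nonEmpty α ∧ nonEmpty β) ∧ P 1 2 0)
      into = trans (windowsInto-eval P (belowMax a b c) (P 1 2 0) (suc (i + j)) (raise j α) β
                     (λ x∈ y∈ → matches-belowMax a b c (left<max x∈) (left<max y∈))
                     (λ x∈ y∈ → matches-aroundMax a b c (right<left x∈ y∈) (left<max x∈)))
                   (cong₂ (λ u v → u ∨ ((v ∧ nonEmpty β) ∧ P 1 2 0)) (lastPair-raise (belowMax a b c) j α) (nonEmpty-raise j α))

  private
    lastPair-++-[] : ∀ F xs m → (∀ {x} → x ∈ xs → x < m) → lastPair F (xs ++ m ∷ []) ≡ nonEmpty xs ∧ F true false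
    lastPair-++-[] F []                 m xs<m = refl
    lastPair-++-[] F (x ∷ [])           m xs<m = cong₂ F (<ᵇ-true (xs<m (here refl))) (<ᵇ-false (<⇒≤ (xs<m (here refl))))
    lastPair-++-[] F (x₁ ∷ x₂ ∷ [])     m xs<m = lastPair-++-[] F (x₂ ∷ []) m (xs<m ∘ there)
    lastPair-++-[] F (x₁ ∷ x₂ ∷ x₃ ∷ r) m xs<m = lastPair-++-[] F (x₂ ∷ x₃ ∷ r) m (xs<m ∘ there)

    lastPair-++-[y] : ∀ F xs m y → lastPair F (xs ++ m ∷ y ∷ []) ≡ F (m <ᵇ y) (y <ᵇ m)
    lastPair-++-[y] F []                 m y = refl
    lastPair-++-[y] F (x ∷ [])           m y = refl
    lastPair-++-[y] F (x₁ ∷ x₂ ∷ [])     m y = lastPair-++-[y] F (x₂ ∷ []) m y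
    lastPair-++-[y] F (x₁ ∷ x₂ ∷ x₃ ∷ r) m y = lastPair-++-[y] F (x₂ ∷ x₃ ∷ r) m y

    lastPair-++-long : ∀ F xs m y z r → lastPair F (xs ++ m ∷ y ∷ z ∷ r) ≡ lastPair F (y ∷ z ∷ r)
    lastPair-++-long F []                 m y z r = refl
    lastPair-++-long F (x ∷ [])           m y z r = refl
    lastPair-++-long F (x₁ ∷ x₂ ∷ [])     m y z r = lastPair-++-long F (x₂ ∷ []) m y z r
    lastPair-++-long F (x₁ ∷ x₂ ∷ x₃ ∷ r′) m y z r = lastPair-++-long F (x₂ ∷ x₃ ∷ r′) m y z r

  module _ (F : Bool → Bool → Bool) where

    lastPair-glue-[] : ∀ {i α} → IsPerm i α → lastPair F (glue α []) ≡ nonEmpty α ∧ F true false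
    lastPair-glue-[] {i} {α} α↭ = begin
      lastPair F (glue α [])                   ≡⟨ cong (lastPair F) (glue-≡ {j = 0} α↭ ↭-refl) ⟩
      lastPair F (raise 0 α ++ suc (i + 0) ∷ []) ≡⟨ lastPair-++-[] F (raise 0 α) (suc (i + 0)) (s≤s ∘ proj₂ ∘ ∈-raise⁻ α↭) ⟩
      nonEmpty (raise 0 α) ∧ F true false       ≡⟨ cong (_∧ F true false) (nonEmpty-raise 0 α) ⟩
      nonEmpty α ∧ F true false                 ∎
      where open ≡-Reasoning

    lastPair-glue-[y] : ∀ {i α y} → IsPerm i α → IsPerm 1 (y ∷ []) → lastPair F (glue α (y ∷ [])) ≡ F false true
    lastPair-glue-[y] {i} {α} {y} α↭ y↭ =
      trans (cong (lastPair F) (glue-≡ α↭ y↭))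
            (trans (lastPair-++-[y] F (raise 1 α) (suc (i + 1)) y) (cong₂ F (<ᵇ-false (<⇒≤ y<m)) (<ᵇ-true y<m)))
      where
      y<m : y < suc (i + 1)
      y<m = s≤s (≤-trans (proj₂ (∈-perm⁻ y↭ (here refl))) (m≤n+m 1 i))

    lastPair-glue-long : ∀ α y z r → lastPair F (glue α (y ∷ z ∷ r)) ≡ lastPair F (y ∷ z ∷ r)
    lastPair-glue-long α y z r = lastPair-++-long F (raise (length (y ∷ z ∷ r)) α) _ y z r

    firstPair-glue-[] : ∀ {j β} → IsPerm j β → firstPair F (glue [] β) ≡ nonEmpty β ∧ F false true
    firstPair-glue-[] {j} {[]}    β↭ = refl
    firstPair-glue-[] {j} {y ∷ β} β↭ = trans (cong (firstPair F) (glue-≡ {0} ↭-refl β↭)) (cong₂ F (<ᵇ-false (<⇒≤ y<m)) (<ᵇ-true y<m))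
      where
      y<m : y < suc j
      y<m = s≤s (proj₂ (∈-perm⁻ β↭ (here refl)))

    firstPair-glue-[x] : ∀ {j x β} → IsPerm 1 (x ∷ []) → IsPerm j β → firstPair F (glue (x ∷ []) β) ≡ F true false
    firstPair-glue-[x] {j} {x} x↭ β↭ =
      trans (cong (firstPair F) (glue-≡ x↭ β↭)) (cong₂ F (<ᵇ-true x<m) (<ᵇ-false (<⇒≤ x<m)))
      where
      x<m : x + j < suc (1 + j)
      x<m = s≤s (proj₂ (∈-raise⁻ x↭ (here refl)))

    firstPair-glue-long : ∀ x x′ r β → firstPair F (glue (x ∷ x′ ∷ r) β) ≡ firstPair F (x ∷ x′ ∷ r)
    firstPair-glue-long x x′ r β = firstPair-raise F (length β) (x ∷ x′ ∷ r)

module PatternRecurrences where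

  open import Defs using (f; dashless; contains; perms)
  open Counting using (count-cong)
  open Permutations using (IsPerm; perm-length)
  open TriplePatterns
  open Decomposition
  open GlueWindows
  open import Data.Nat using (ℕ; zero; suc; _≡ᵇ_)
  open import Data.Bool using (Bool; true; false; _∧_; _∨_; not; T)
  open import Data.Bool.Properties using (∧-assoc; T-∨; T-≡)
  open import Data.Sum using ([_,_]′)
  open import Function using (Equivalence; _∘_)
  open import Data.List using (List; []; _∷_; length)
  open Pattern132 using (Has132; Has132-⊆; avoids132; avoids132⁻)
  open import Data.List.Relation.Binary.Sublist.Propositional using (_∷_; _∷ʳ_; minimum; ⊆-refl)
  open import Data.Product using (_,_)
  open import Data.Empty using (⊥-elim)
  open import Relation.Binary.PropositionalEquality

  avoiding : ℕ → ℕ → ℕ → List ℕ → Bool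
  avoiding a b c σ = not (anyWindow (matches a b c) σ)

  f≡count132 : ∀ a b c n → f (dashless a b c) n ≡ count132 (avoiding a b c) n
  f≡count132 a b c n = count-cong (perms n) λ {σ} _ → cong (λ w → avoids132 σ ∧ not w) (contains-dashless a b c σ)

  anyWindow132⇒Has132 : ∀ σ → T (anyWindow (matches 1 3 2) σ) → Has132 σ
  anyWindow132⇒Has132 []          ()
  anyWindow132⇒Has132 (_ ∷ [])    ()
  anyWindow132⇒Has132 (_ ∷ _ ∷ []) ()
  anyWindow132⇒Has132 (x ∷ y ∷ z ∷ r) occ = [ atHead , Has132-⊆ (x ∷ʳ ⊆-refl) ∘ anyWindow132⇒Has132 (y ∷ z ∷ r) ]′
                                               (Equivalence.to T-∨ occ)
    where
    atHead : T (matches 1 3 2 x y z) → Has132 (x ∷ y ∷ z ∷ r)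
    atHead occ = let order = matches-true⁻ {x} {y} {z} {1} {3} {2} (Equivalence.to T-≡ occ)
                 in x , y , z , refl ∷ refl ∷ refl ∷ minimum r , <ᵇ-true⁻ (SameOrder.xz order) , <ᵇ-true⁻ (SameOrder.zy order)

  f132≡count132 : ∀ n → f (dashless 1 3 2) n ≡ count132 (λ _ → true) n
  f132≡count132 n = count-cong (perms n) λ {σ} _ → avoiding132 σ
    where
    avoiding132 : ∀ σ → avoids132 σ ∧ not (contains (dashless 1 3 2) σ) ≡ avoids132 σ ∧ true
    avoiding132 σ with avoids132 σ in av
    ... | false = refl
    ... | true with contains (dashless 1 3 2) σ in occ
    ...   | false = refl
    ...   | true  = ⊥-elim (avoids132⁻ (subst T (sym av) _)
                      (anyWindow132⇒Has132 σ (subst T (trans (sym occ) (contains-dashless 1 3 2 σ)) _)))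

  lastPair-false : ∀ {F} → (∀ t s → F t s ≡ false) → ∀ σ → lastPair F σ ≡ false
  lastPair-false F≡false []              = refl
  lastPair-false F≡false (x ∷ [])        = refl
  lastPair-false F≡false (x ∷ y ∷ [])    = F≡false _ _
  lastPair-false F≡false (x ∷ y ∷ z ∷ r) = lastPair-false F≡false (y ∷ z ∷ r)

  firstPair-false : ∀ {F} → (∀ t s → F t s ≡ false) → ∀ σ → firstPair F σ ≡ false
  firstPair-false F≡false []          = refl
  firstPair-false F≡false (x ∷ [])    = refl
  firstPair-false F≡false (x ∷ y ∷ r) = F≡false _ _

  private
    glued-sizes : ∀ {P : ℕ → ℕ → List ℕ → List ℕ → Set} →
      (∀ α β → IsPerm (length α) α → IsPerm (length β) β → P (length α) (length β) α β) →
      ∀ {i j α β} → IsPerm i α → IsPerm j β → P i j α β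
    glued-sizes P-sizes α↭ β↭ with refl ← perm-length α↭ | refl ← perm-length β↭ = P-sizes _ _ α↭ β↭

  positive : ℕ → Bool
  positive n = not (n ≡ᵇ 0)

  -- If β has at most one entry, glue α β ends with the ascent (last of α, maximum) or the descent (maximum, y);
  -- endCondition ascent descent |α| |β| says whether that is allowed when ending in an ascent (descent) is forbidden.
  -- startCondition is the mirror image for the start of glue α β.
  endCondition : Bool → Bool → ℕ → ℕ → Bool
  endCondition ascent descent i zero          = not (positive i ∧ ascent)
  endCondition ascent descent i (suc zero)    = not descent
  endCondition ascent descent i (suc (suc _)) = true

  startCondition : Bool → Bool → ℕ → ℕ → Bool
  startCondition ascent descent zero          j = not (positive j ∧ descent)
  startCondition ascent descent (suc zero)    j = not ascent
  startCondition ascent descent (suc (suc _)) j = true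

  private
    not-∨-left : ∀ p q r s → not ((p ∨ (q ∨ (r ∧ false))) ∨ (false ∨ s)) ≡ (true ∧ (not p ∧ not q)) ∧ not s
    not-∨-left true  _     _     _ = refl
    not-∨-left false true  _     _ = refl
    not-∨-left false false true  _ = refl
    not-∨-left false false false _ = refl

    not-∨-right : ∀ p r q s → not ((p ∨ (false ∨ (r ∧ false))) ∨ (q ∨ s)) ≡ (true ∧ not p) ∧ (not s ∧ not q)
    not-∨-right true  _     _     _     = refl
    not-∨-right false true  true  true  = refl
    not-∨-right false true  true  false = refl
    not-∨-right false true  false true  = refl
    not-∨-right false true  false false = refl
    not-∨-right false false true  true  = refl
    not-∨-right false false true  false = refl
    not-∨-right false false false true  = refl
    not-∨-right false false false false = refl

    swap-∧-true : ∀ e v → ((true ∧ e) ∧ true) ∧ not v ≡ (not v ∧ e) ∧ true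
    swap-∧-true true  true  = refl
    swap-∧-true true  false = refl
    swap-∧-true false true  = refl
    swap-∧-true false false = refl

    swap-true-∧ : ∀ e v → ((true ∧ true) ∧ e) ∧ not v ≡ (not v ∧ true) ∧ e
    swap-true-∧ true  true  = refl
    swap-true-∧ true  false = refl
    swap-true-∧ false true  = refl
    swap-true-∧ false false = refl

    rotate-∧ : ∀ p s q → ((true ∧ p) ∧ s) ∧ not q ≡ (true ∧ (p ∧ not q)) ∧ s
    rotate-∧ false _     _     = refl
    rotate-∧ true  true  true  = refl
    rotate-∧ true  true  false = refl
    rotate-∧ true  false true  = refl
    rotate-∧ true  false false = refl

  module EndConstrained (a b c : ℕ) (above≡false : ∀ t s → aboveMax a b c t s ≡ false)
                        (across≡false : matches a b c 1 2 0 ≡ false) where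

    endFree : List ℕ → Bool
    endFree σ = avoiding a b c σ ∧ not (lastPair (belowMax a b c) σ)

    avoiding-glue : ∀ {i j α β} → IsPerm i α → IsPerm j β →
                    avoiding a b c (glue α β) ≡ (true ∧ endFree α) ∧ avoiding a b c β
    avoiding-glue {α = α} {β} α↭ β↭ rewrite anyWindow-glue α↭ β↭ a b c | firstPair-false above≡false β | across≡false =
      not-∨-left (anyWindow (matches a b c) α) (lastPair (belowMax a b c) α) (nonEmpty α ∧ nonEmpty β) (anyWindow (matches a b c) β)

    endFree-glue : ∀ {i j α β} → IsPerm i α → IsPerm j β → endFree (glue α β) ≡
                   (endCondition (belowMax a b c true false) (belowMax a b c false true) i j ∧ endFree α) ∧ endFree β
    endFree-glue = glued-sizes sized
      where
      L = lastPair (belowMax a b c)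
      sized : ∀ α β → IsPerm (length α) α → IsPerm (length β) β → endFree (glue α β) ≡
              (endCondition (belowMax a b c true false) (belowMax a b c false true) (length α) (length β) ∧ endFree α) ∧ endFree β
      sized []      []          α↭ β↭ = refl
      sized (x ∷ α) []          α↭ β↭ = trans (cong₂ _∧_ (avoiding-glue α↭ β↭) (cong not (lastPair-glue-[] (belowMax a b c) α↭)))
                                              (swap-∧-true (endFree (x ∷ α)) (belowMax a b c true false))
      sized α       (y ∷ [])    α↭ β↭ = trans (cong₂ _∧_ (avoiding-glue α↭ β↭) (cong not (lastPair-glue-[y] (belowMax a b c) α↭ β↭)))
                                              (swap-∧-true (endFree α) (belowMax a b c false true))
      sized α       (y ∷ z ∷ r) α↭ β↭ = trans (cong₂ _∧_ (avoiding-glue α↭ β↭) (cong not (lastPair-glue-long (belowMax a b c) α y z r)))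
                                              (∧-assoc (true ∧ endFree α) (avoiding a b c (y ∷ z ∷ r)) (not (L (y ∷ z ∷ r))))

  module StartConstrained (a b c : ℕ) (below≡false : ∀ t s → belowMax a b c t s ≡ false)
                          (across≡false : matches a b c 1 2 0 ≡ false) where

    startFree : List ℕ → Bool
    startFree σ = avoiding a b c σ ∧ not (firstPair (aboveMax a b c) σ)

    avoiding-glue : ∀ {i j α β} → IsPerm i α → IsPerm j β →
                    avoiding a b c (glue α β) ≡ (true ∧ avoiding a b c α) ∧ startFree β
    avoiding-glue {α = α} {β} α↭ β↭ rewrite anyWindow-glue α↭ β↭ a b c | lastPair-false below≡false α | across≡false =
      not-∨-right (anyWindow (matches a b c) α) (nonEmpty α ∧ nonEmpty β) (firstPair (aboveMax a b c) β) (anyWindow (matches a b c) β)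

    startFree-glue : ∀ {i j α β} → IsPerm i α → IsPerm j β → startFree (glue α β) ≡
                     (startCondition (aboveMax a b c true false) (aboveMax a b c false true) i j ∧ startFree α) ∧ startFree β
    startFree-glue = glued-sizes sized
      where
      S = firstPair (aboveMax a b c)
      sized : ∀ α β → IsPerm (length α) α → IsPerm (length β) β → startFree (glue α β) ≡
              (startCondition (aboveMax a b c true false) (aboveMax a b c false true) (length α) (length β) ∧ startFree α) ∧ startFree β
      sized []               []      α↭ β↭ = refl
      sized []               (y ∷ β) α↭ β↭ = trans (cong₂ _∧_ (avoiding-glue α↭ β↭) (cong not (firstPair-glue-[] (aboveMax a b c) β↭)))
                                                   (swap-true-∧ (startFree (y ∷ β)) (aboveMax a b c false true))
      sized (x ∷ [])         β       α↭ β↭ = trans (cong₂ _∧_ (avoiding-glue α↭ β↭) (cong not (firstPair-glue-[x] (aboveMax a b c) α↭ β↭)))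
                                                   (swap-true-∧ (startFree β) (aboveMax a b c true false))
      sized (x ∷ x′ ∷ r)     β       α↭ β↭ = trans (cong₂ _∧_ (avoiding-glue α↭ β↭) (cong not (firstPair-glue-long (aboveMax a b c) x x′ r β)))
                                                   (rotate-∧ (avoiding a b c (x ∷ x′ ∷ r)) (startFree β) (S (x ∷ x′ ∷ r)))

  avoiding231-glue : ∀ {i j α β} → IsPerm i α → IsPerm j β →
                     avoiding 2 3 1 (glue α β) ≡ (not (positive i ∧ positive j) ∧ avoiding 2 3 1 α) ∧ avoiding 2 3 1 β
  avoiding231-glue = glued-sizes sized
    where
    W = anyWindow (matches 2 3 1)
    not-∨-231 : ∀ p r s → not ((p ∨ (false ∨ (r ∧ true))) ∨ (false ∨ s)) ≡ (not r ∧ not p) ∧ not s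
    not-∨-231 true  true  _ = refl
    not-∨-231 true  false _ = refl
    not-∨-231 false true  _ = refl
    not-∨-231 false false _ = refl
    nonEmpty≡positive : ∀ σ → nonEmpty σ ≡ positive (length σ)
    nonEmpty≡positive []      = refl
    nonEmpty≡positive (_ ∷ _) = refl
    sized : ∀ α β → IsPerm (length α) α → IsPerm (length β) β →
            avoiding 2 3 1 (glue α β) ≡ (not (positive (length α) ∧ positive (length β)) ∧ avoiding 2 3 1 α) ∧ avoiding 2 3 1 β
    sized α β α↭ β↭
      rewrite anyWindow-glue α↭ β↭ 2 3 1
            | lastPair-false {belowMax 2 3 1} (three-way-false refl refl refl) α
            | firstPair-false {aboveMax 2 3 1} (three-way-false refl refl refl) β
            | nonEmpty≡positive α | nonEmpty≡positive β
      = not-∨-231 (W α) (positive (length α) ∧ positive (length β)) (W β)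

module Sequences where

  open Decomposition using (count132; count132-suc)
  open PatternRecurrences
  open GlueWindows using (three-way-false)
  open NatConvolution
  open import Data.Nat using (ℕ; zero; suc; _+_; _*_)
  open import Data.Nat.Properties using (*-comm; +-identityʳ)
  open import Data.Nat.Tactic.RingSolver using (solve-∀)
  open import Data.Bool using (true; false; not; _∧_; if_then_else_)
  open import Relation.Binary.PropositionalEquality

  endCondition≡startCondition : ∀ u d i j → endCondition u d i j ≡ startCondition d u j i
  endCondition≡startCondition u d i zero          = refl
  endCondition≡startCondition u d i (suc zero)    = refl
  endCondition≡startCondition u d i (suc (suc j)) = refl

  conditional-product-cong : ∀ c {a b : ℕ → ℕ} {i j} → a i ≡ b i → a j ≡ b j →
    (if c then a i * a j else 0) ≡ (if c then b i * b j else 0)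
  conditional-product-cong c aᵢ≡bᵢ aⱼ≡bⱼ = cong₂ (λ x y → if c then x * y else 0) aᵢ≡bᵢ aⱼ≡bⱼ

  mirror-recurrences : ∀ u d {A E A′ E′ : ℕ → ℕ} →
    (∀ n → A (suc n) ≡ csum (λ i j → E i * A j) n) →
    (∀ n → E (suc n) ≡ csum (λ i j → if endCondition u d i j then E i * E j else 0) n) →
    (∀ n → A′ (suc n) ≡ csum (λ i j → A′ i * E′ j) n) →
    (∀ n → E′ (suc n) ≡ csum (λ i j → if startCondition d u i j then E′ i * E′ j else 0) n) →
    A 0 ≡ A′ 0 → E 0 ≡ E′ 0 → ∀ n → A n ≡ A′ n
  mirror-recurrences u d {A} {E} {A′} {E′} rec-A rec-E rec-A′ rec-E′ A₀ E₀ =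
    recurrence-unique (csum-causal (λ a i j → E i * a j) λ _ aⱼ≡bⱼ → cong (E _ *_) aⱼ≡bⱼ) A₀ rec-A rec-A″
    where
    E-step = λ (e : ℕ → ℕ) → csum (λ i j → if endCondition u d i j then e i * e j else 0)
    rec-E″ : ∀ n → E′ (suc n) ≡ E-step E′ n
    rec-E″ n = trans (rec-E′ n) (trans (csum-swap _ n) (csum-cong n λ i j _ →
      trans (cong (λ c → if c then E′ j * E′ i else 0) (sym (endCondition≡startCondition u d i j)))
            (cong (λ x → if endCondition u d i j then x else 0) (*-comm (E′ j) (E′ i)))))
    E≗E′ : ∀ n → E n ≡ E′ n
    E≗E′ = recurrence-unique (csum-causal (λ e i j → if endCondition u d i j then e i * e j else 0)
                                          (λ {a} {b} {i} {j} → conditional-product-cong (endCondition u d i j) {a} {b} {i} {j})) E₀ rec-E rec-E″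
    rec-A″ : ∀ n → A′ (suc n) ≡ csum (λ i j → E i * A′ j) n
    rec-A″ n = trans (rec-A′ n) (trans (csum-swap _ n) (csum-cong n λ i j _ → trans (*-comm (A′ j) (E′ i)) (cong (_* A′ j) (sym (E≗E′ i)))))

  private
    module P123 = EndConstrained   1 2 3 (three-way-false refl refl refl) refl
    module P213 = EndConstrained   2 1 3 (three-way-false refl refl refl) refl
    module P321 = StartConstrained 3 2 1 (three-way-false refl refl refl) refl
    module P312 = StartConstrained 3 1 2 (three-way-false refl refl refl) refl

  A₁₂₃ E₁₂₃ A₃₂₁ E₃₂₁ A₂₁₃ E₂₁₃ A₃₁₂ E₃₁₂ A₂₃₁ A₁₃₂ : ℕ → ℕ
  A₁₂₃ = count132 (avoiding 1 2 3)
  E₁₂₃ = count132 P123.endFree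
  A₃₂₁ = count132 (avoiding 3 2 1)
  E₃₂₁ = count132 P321.startFree
  A₂₁₃ = count132 (avoiding 2 1 3)
  E₂₁₃ = count132 P213.endFree
  A₃₁₂ = count132 (avoiding 3 1 2)
  E₃₁₂ = count132 P312.startFree
  A₂₃₁ = count132 (avoiding 2 3 1)
  A₁₃₂ = count132 (λ _ → true)

  A₁₂₃-suc : ∀ n → A₁₂₃ (suc n) ≡ csum (λ i j → E₁₂₃ i * A₁₂₃ j) n
  A₁₂₃-suc = count132-suc λ α↭ β↭ _ _ → P123.avoiding-glue α↭ β↭

  E₁₂₃-suc : ∀ n → E₁₂₃ (suc n) ≡ csum (λ i j → if endCondition true false i j then E₁₂₃ i * E₁₂₃ j else 0) n
  E₁₂₃-suc = count132-suc λ α↭ β↭ _ _ → P123.endFree-glue α↭ β↭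

  A₃₂₁-suc : ∀ n → A₃₂₁ (suc n) ≡ csum (λ i j → A₃₂₁ i * E₃₂₁ j) n
  A₃₂₁-suc = count132-suc λ α↭ β↭ _ _ → P321.avoiding-glue α↭ β↭

  E₃₂₁-suc : ∀ n → E₃₂₁ (suc n) ≡ csum (λ i j → if startCondition false true i j then E₃₂₁ i * E₃₂₁ j else 0) n
  E₃₂₁-suc = count132-suc λ α↭ β↭ _ _ → P321.startFree-glue α↭ β↭

  A₂₁₃-suc : ∀ n → A₂₁₃ (suc n) ≡ csum (λ i j → E₂₁₃ i * A₂₁₃ j) n
  A₂₁₃-suc = count132-suc λ α↭ β↭ _ _ → P213.avoiding-glue α↭ β↭

  E₂₁₃-suc : ∀ n → E₂₁₃ (suc n) ≡ csum (λ i j → if endCondition false true i j then E₂₁₃ i * E₂₁₃ j else 0) n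
  E₂₁₃-suc = count132-suc λ α↭ β↭ _ _ → P213.endFree-glue α↭ β↭

  A₃₁₂-suc : ∀ n → A₃₁₂ (suc n) ≡ csum (λ i j → A₃₁₂ i * E₃₁₂ j) n
  A₃₁₂-suc = count132-suc λ α↭ β↭ _ _ → P312.avoiding-glue α↭ β↭

  E₃₁₂-suc : ∀ n → E₃₁₂ (suc n) ≡ csum (λ i j → if startCondition true false i j then E₃₁₂ i * E₃₁₂ j else 0) n
  E₃₁₂-suc = count132-suc λ α↭ β↭ _ _ → P312.startFree-glue α↭ β↭

  A₂₃₁-suc : ∀ n → A₂₃₁ (suc n) ≡ csum (λ i j → if not (positive i ∧ positive j) then A₂₃₁ i * A₂₃₁ j else 0) n
  A₂₃₁-suc = count132-suc λ α↭ β↭ _ _ → avoiding231-glue α↭ β↭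

  A₁₃₂-suc : ∀ n → A₁₃₂ (suc n) ≡ csum (λ i j → A₁₃₂ i * A₁₃₂ j) n
  A₁₃₂-suc = count132-suc λ _ _ _ _ → refl

  A₃₂₁≗A₁₂₃ : ∀ n → A₃₂₁ n ≡ A₁₂₃ n
  A₃₂₁≗A₁₂₃ n =
    sym (mirror-recurrences true false {A₁₂₃} {E₁₂₃} {A₃₂₁} {E₃₂₁} A₁₂₃-suc E₁₂₃-suc A₃₂₁-suc E₃₂₁-suc refl refl n)

  A₃₁₂≗A₂₁₃ : ∀ n → A₃₁₂ n ≡ A₂₁₃ n
  A₃₁₂≗A₂₁₃ n =
    sym (mirror-recurrences false true {A₂₁₃} {E₂₁₃} {A₃₁₂} {E₃₁₂} A₂₁₃-suc E₂₁₃-suc A₃₁₂-suc E₃₁₂-suc refl refl n)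

  E₁₂₃-suc≗A₁₂₃ : ∀ n → E₁₂₃ (suc n) ≡ A₁₂₃ n
  E₁₂₃-suc≗A₁₂₃ = recurrence-unique {step = λ a → csum (λ i j → E₁₂₃ i * a j)}
    (csum-causal (λ a i j → E₁₂₃ i * a j) λ {_} {_} {i} _ aⱼ≡bⱼ → cong (E₁₂₃ i *_) aⱼ≡bⱼ) refl E-rec A₁₂₃-suc
    where
    E-rec : ∀ m → E₁₂₃ (suc (suc m)) ≡ csum (λ i j → E₁₂₃ i * E₁₂₃ (suc j)) m
    E-rec m = begin
      E₁₂₃ (suc (suc m))
        ≡⟨ E₁₂₃-suc (suc m) ⟩
      csum G (suc m)
        ≡⟨ csum-sucʳ G m ⟩
      csum (λ i j → G i (suc j)) m + 0
        ≡⟨ +-identityʳ _ ⟩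
      csum (λ i j → G i (suc j)) m
        ≡⟨ csum-cong m (λ { i zero _ → refl ; i (suc j) _ → refl }) ⟩
      csum (λ i j → E₁₂₃ i * E₁₂₃ (suc j)) m ∎
      where
      open ≡-Reasoning
      G = λ i j → if endCondition true false i j then E₁₂₃ i * E₁₂₃ j else 0

  E₂₁₃-suc-suc : ∀ m → E₂₁₃ (suc (suc m)) + E₂₁₃ m ≡ csum (λ i j → E₂₁₃ i * E₂₁₃ j) (suc m)
  E₂₁₃-suc-suc m = begin
    E₂₁₃ (suc (suc m)) + E₂₁₃ m
      ≡⟨ cong (_+ E₂₁₃ m) (trans (E₂₁₃-suc (suc m)) (csum-sucʳ G m)) ⟩
    csum (λ i j → G i (suc j)) m + E₂₁₃ (suc m) * E₂₁₃ 0 + E₂₁₃ m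
      ≡⟨ regroup (csum (λ i j → G i (suc j)) m) (E₂₁₃ (suc m) * E₂₁₃ 0) (E₂₁₃ m) ⟩
    csum (λ i j → G i (suc j)) m + E₂₁₃ m * E₂₁₃ 1 + E₂₁₃ (suc m) * E₂₁₃ 0
      ≡⟨ cong (_+ E₂₁₃ (suc m) * E₂₁₃ 0) (csum-column₀ (λ i j → G i (suc j)) (λ i j → E₂₁₃ i * E₂₁₃ (suc j)) m
                                                      (λ _ → refl) (λ _ _ → refl)) ⟩
    csum (λ i j → E₂₁₃ i * E₂₁₃ (suc j)) m + E₂₁₃ (suc m) * E₂₁₃ 0
      ≡⟨ csum-sucʳ (λ i j → E₂₁₃ i * E₂₁₃ j) m ⟨
    csum (λ i j → E₂₁₃ i * E₂₁₃ j) (suc m) ∎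
    where
    open ≡-Reasoning
    G = λ i j → if endCondition false true i j then E₂₁₃ i * E₂₁₃ j else 0
    regroup : ∀ h x e → h + x + e ≡ h + e * 1 + x
    regroup = solve-∀

  A₂₃₁-suc-suc : ∀ m → A₂₃₁ (suc (suc m)) ≡ A₂₃₁ (suc m) + A₂₃₁ (suc m)
  A₂₃₁-suc-suc m = begin
    A₂₃₁ (suc (suc m))
      ≡⟨ A₂₃₁-suc (suc m) ⟩
    1 * A₂₃₁ (suc m) + csum (λ i j → G (suc i) j) m
      ≡⟨ cong (1 * A₂₃₁ (suc m) +_) (sym (csum-column₀ (λ _ _ → 0) (λ i j → G (suc i) j) m (λ _ → refl) λ _ _ → refl)) ⟩
    1 * A₂₃₁ (suc m) + (csum (λ _ _ → 0) m + A₂₃₁ (suc m) * 1)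
      ≡⟨ cong (λ z → 1 * A₂₃₁ (suc m) + (z + A₂₃₁ (suc m) * 1)) (csum-zero m) ⟩
    1 * A₂₃₁ (suc m) + (0 + A₂₃₁ (suc m) * 1)
      ≡⟨ double (A₂₃₁ (suc m)) ⟩
    A₂₃₁ (suc m) + A₂₃₁ (suc m) ∎
    where
    open ≡-Reasoning
    G = λ i j → if not (positive i ∧ positive j) then A₂₃₁ i * A₂₃₁ j else 0
    double : ∀ x → 1 * x + (0 + x * 1) ≡ x + x
    double = solve-∀

module GeneratingFunctions where

  open import Defs using (F; f; dashless; poly; _⊛_; _⊕_; _⊖_)
  open PowerSeries
  open NatConvolution using (csum)
  open PatternRecurrences using (f≡count132; f132≡count132)
  open Sequences
  open import Data.Nat as ℕ using (ℕ; zero; suc)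
  open import Data.Integer as ℤ using (ℤ; +_; -_; _+_; _*_; _-_)
  import Data.Integer.Properties as ℤ
  open import Data.Integer.Tactic.RingSolver using (solve-∀)
  open import Data.List using ([]; _∷_)
  open import Data.Product using (_×_; ∃-syntax)
  open import Relation.Binary.PropositionalEquality

  embed-recurrence : ∀ a b c → a 0 ≡ 1 → (∀ n → a (suc n) ≡ csum (λ i j → b i ℕ.* c j) n) →
                     embed a ≗ one ⊕ X ⊛ (embed b ⊛ embed c)
  embed-recurrence a b c a₀ rec = ≗-cst⊕X⊛ (cong +_ a₀) λ n → trans (cong +_ (rec n)) (sym (embed-⊛ b c n))

  quadratic-cong : ∀ A B {F F′} → F ≗ F′ → A ⊛ F′ ≗ one ⊕ B ⊛ (F′ ⊛ F′) → A ⊛ F ≗ one ⊕ B ⊛ (F ⊛ F)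
  quadratic-cong A B {F} {F′} F≗F′ eq =
    R.trans (⊛-cong {A} {A} (λ _ → refl) F≗F′)
            (R.trans eq (R.+-congˡ {one} (⊛-cong {B} {B} (λ _ → refl) (⊛-cong (R.sym F≗F′) (R.sym F≗F′)))))

  F≗embed : ∀ a b c → F (dashless a b c) ≗ embed (Decomposition.count132 (PatternRecurrences.avoiding a b c))
  F≗embed a b c n = cong +_ (f≡count132 a b c n)

  catalan : embed A₁₃₂ ≗ one ⊕ X ⊛ (embed A₁₃₂ ⊛ embed A₁₃₂)
  catalan = embed-recurrence A₁₃₂ A₁₃₂ A₁₃₂ refl A₁₃₂-suc

  closed-form-132 : ∃[ G ] ((∀ n → (G ⊛ G) n ≡ poly (+ 1 ∷ - (+ 4) ∷ []) n)
                                × G 0 ≡ + 1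
                                × (∀ n → (poly (+ 0 ∷ + 2 ∷ []) ⊛ F (dashless 1 3 2)) n ≡ (poly (+ 1 ∷ []) ⊖ G) n))
  closed-form-132 = quadratic-closed-form [] (+ 1 ∷ []) (+ 1 ∷ - (+ 4) ∷ []) (F (dashless 1 3 2))
    (quadratic-cong (horner (+ 1 ∷ [])) (horner (+ 0 ∷ + 1 ∷ [])) (λ n → cong +_ (f132≡count132 n)) equation)
    (solve 1 (λ x → hornerₑ (+ 1 ∷ - (+ 4) ∷ []) x
                    := hornerₑ (+ 1 ∷ []) x :* hornerₑ (+ 1 ∷ []) x :- con (+ 4) :* hornerₑ (+ 0 ∷ + 1 ∷ []) x)
           R.refl X)
    where
    C = embed A₁₃₂
    equation : horner (+ 1 ∷ []) ⊛ C ≗ one ⊕ horner (+ 0 ∷ + 1 ∷ []) ⊛ (C ⊛ C)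
    equation = ≗-by-residual {K = one}
      (solve 2 (λ C x → hornerₑ (+ 1 ∷ []) x :* C
                     := (con (+ 1) :+ hornerₑ (+ 0 ∷ + 1 ∷ []) x :* (C :* C)) :+ con (+ 1) :* (C :+ :- (con (+ 1) :+ x :* (C :* C))))
               R.refl C X)
      catalan

  closed-form-123 : ∃[ G ] ((∀ n → (G ⊛ G) n ≡ poly (+ 1 ∷ - (+ 2) ∷ - (+ 3) ∷ []) n)
                                × G 0 ≡ + 1
                                × (∀ n → (poly (+ 0 ∷ + 0 ∷ + 2 ∷ []) ⊛ F (dashless 1 2 3)) n
                                         ≡ (poly (+ 1 ∷ - (+ 1) ∷ []) ⊖ G) n))
  closed-form-123 = quadratic-closed-form (- (+ 1) ∷ []) (+ 0 ∷ + 1 ∷ []) (+ 1 ∷ - (+ 2) ∷ - (+ 3) ∷ []) (F (dashless 1 2 3))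
    (quadratic-cong (horner (+ 1 ∷ - (+ 1) ∷ [])) (horner (+ 0 ∷ + 0 ∷ + 1 ∷ [])) (F≗embed 1 2 3) equation)
    (solve 1 (λ x → hornerₑ (+ 1 ∷ - (+ 2) ∷ - (+ 3) ∷ []) x
                    := hornerₑ (+ 1 ∷ - (+ 1) ∷ []) x :* hornerₑ (+ 1 ∷ - (+ 1) ∷ []) x :- con (+ 4) :* hornerₑ (+ 0 ∷ + 0 ∷ + 1 ∷ []) x)
           R.refl X)
    where
    M = embed A₁₂₃
    N = embed E₁₂₃
    M-eq : M ≗ one ⊕ X ⊛ (N ⊛ M)
    M-eq = embed-recurrence A₁₂₃ E₁₂₃ A₁₂₃ refl A₁₂₃-suc
    N-eq : N ≗ one ⊕ X ⊛ M
    N-eq = ≗-cst⊕X⊛ refl (λ n → cong +_ (E₁₂₃-suc≗A₁₂₃ n))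
    equation : horner (+ 1 ∷ - (+ 1) ∷ []) ⊛ M ≗ one ⊕ horner (+ 0 ∷ + 0 ∷ + 1 ∷ []) ⊛ (M ⊛ M)
    equation = ≗-by-residual {K = one} (≗-by-residual {K = X ⊛ M}
      (solve 3 (λ M N x → hornerₑ (+ 1 ∷ - (+ 1) ∷ []) x :* M
                       := ((con (+ 1) :+ hornerₑ (+ 0 ∷ + 0 ∷ + 1 ∷ []) x :* (M :* M)) :+ con (+ 1) :* (M :+ :- (con (+ 1) :+ x :* (N :* M))))
                          :+ (x :* M) :* (N :+ :- (con (+ 1) :+ x :* M)))
               R.refl M N X)
      N-eq) M-eq

  closed-form-213 : ∃[ G ] ((∀ n → (G ⊛ G) n ≡ poly (+ 1 ∷ - (+ 4) ∷ + 2 ∷ + 0 ∷ + 1 ∷ []) n)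
                            × G 0 ≡ + 1
                            × (∀ n → (poly (+ 0 ∷ + 2 ∷ - (+ 2) ∷ []) ⊛ F (dashless 2 1 3)) n
                                     ≡ (poly (+ 1 ∷ + 0 ∷ - (+ 1) ∷ []) ⊖ G) n))
  closed-form-213 = quadratic-closed-form (+ 0 ∷ - (+ 1) ∷ []) (+ 1 ∷ - (+ 1) ∷ []) (+ 1 ∷ - (+ 4) ∷ + 2 ∷ + 0 ∷ + 1 ∷ [])
    (F (dashless 2 1 3))
    (quadratic-cong (horner (+ 1 ∷ + 0 ∷ - (+ 1) ∷ [])) (horner (+ 0 ∷ + 1 ∷ - (+ 1) ∷ [])) (F≗embed 2 1 3) equation)
    (solve 1 (λ x → hornerₑ (+ 1 ∷ - (+ 4) ∷ + 2 ∷ + 0 ∷ + 1 ∷ []) x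
                    := hornerₑ (+ 1 ∷ + 0 ∷ - (+ 1) ∷ []) x :* hornerₑ (+ 1 ∷ + 0 ∷ - (+ 1) ∷ []) x
                       :- con (+ 4) :* hornerₑ (+ 0 ∷ + 1 ∷ - (+ 1) ∷ []) x)
           R.refl X)
    where
    M = embed A₂₁₃
    N = embed E₂₁₃
    M-eq : M ≗ one ⊕ X ⊛ (N ⊛ M)
    M-eq = embed-recurrence A₂₁₃ E₂₁₃ A₂₁₃ refl A₂₁₃-suc
    a≡a+b-b : ∀ a b → a ≡ (a + b) - b
    a≡a+b-b = solve-∀
    N-eq : N ≗ one ⊕ X ⊛ (N ⊛ N ⊕ neg (X ⊛ N))
    N-eq = ≗-cst⊕X⊛ {B = N ⊛ N ⊕ neg (X ⊛ N)} refl λ where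
      zero    → refl
      (suc m) → begin
        + E₂₁₃ (suc (suc m))
          ≡⟨ a≡a+b-b _ (+ E₂₁₃ m) ⟩
        (+ E₂₁₃ (suc (suc m)) + + E₂₁₃ m) - + E₂₁₃ m
          ≡⟨ cong (_- + E₂₁₃ m) (sym (ℤ.pos-+ (E₂₁₃ (suc (suc m))) (E₂₁₃ m))) ⟩
        + (E₂₁₃ (suc (suc m)) ℕ.+ E₂₁₃ m) - + E₂₁₃ m
          ≡⟨ cong (λ k → + k - + E₂₁₃ m) (E₂₁₃-suc-suc m) ⟩
        + csum (λ i j → E₂₁₃ i ℕ.* E₂₁₃ j) (suc m) - + E₂₁₃ m
          ≡⟨ cong₂ _-_ (sym (embed-⊛ E₂₁₃ E₂₁₃ (suc m))) (sym (X⊛-suc N m)) ⟩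
        (N ⊛ N) (suc m) - (X ⊛ N) (suc m) ∎
        where open ≡-Reasoning
    equation : horner (+ 1 ∷ + 0 ∷ - (+ 1) ∷ []) ⊛ M ≗ one ⊕ horner (+ 0 ∷ + 1 ∷ - (+ 1) ∷ []) ⊛ (M ⊛ M)
    equation = ≗-by-residual {K = (cst (+ 1) ⊕ X ⊛ X) ⊛ M ⊕ neg (cst (+ 2) ⊛ (M ⊕ neg one)) ⊕ (M ⊕ neg (one ⊕ X ⊛ (N ⊛ M)))}
      (≗-by-residual {K = X ⊛ (M ⊛ M)}
        (solve 3 (λ M N x → hornerₑ (+ 1 ∷ + 0 ∷ - (+ 1) ∷ []) x :* M
                         := ((con (+ 1) :+ hornerₑ (+ 0 ∷ + 1 ∷ - (+ 1) ∷ []) x :* (M :* M))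
                             :+ ((con (+ 1) :+ x :* x) :* M :+ :- (con (+ 2) :* (M :+ :- con (+ 1))) :+ (M :+ :- (con (+ 1) :+ x :* (N :* M))))
                                :* (M :+ :- (con (+ 1) :+ x :* (N :* M))))
                            :+ (x :* (M :* M)) :* (N :+ :- (con (+ 1) :+ x :* (N :* N :+ :- (x :* N)))))
                 R.refl M N X)
        N-eq)
      M-eq

  closed-form-231 : ∀ n → (poly (+ 1 ∷ - (+ 2) ∷ []) ⊛ F (dashless 2 3 1)) n ≡ poly (+ 1 ∷ - (+ 1) ∷ []) n
  closed-form-231 = R.trans (⊛-cong (poly≗horner (+ 1 ∷ - (+ 2) ∷ [])) (F≗embed 2 3 1))
                         (R.trans equation (R.sym (poly≗horner (+ 1 ∷ - (+ 1) ∷ []))))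
    where
    D = embed A₂₃₁
    doubling : ∀ a → a + a ≡ + 2 * a + - + 0
    doubling = solve-∀
    D-eq : D ≗ one ⊕ X ⊛ (cst (+ 2) ⊛ D ⊕ neg one)
    D-eq = ≗-cst⊕X⊛ {B = cst (+ 2) ⊛ D ⊕ neg one} refl λ where
      zero    → refl
      (suc m) → begin
        + A₂₃₁ (suc (suc m))                      ≡⟨ cong +_ (A₂₃₁-suc-suc m) ⟩
        + (A₂₃₁ (suc m) ℕ.+ A₂₃₁ (suc m))         ≡⟨ ℤ.pos-+ (A₂₃₁ (suc m)) (A₂₃₁ (suc m)) ⟩
        + A₂₃₁ (suc m) + + A₂₃₁ (suc m)           ≡⟨ doubling (+ A₂₃₁ (suc m)) ⟩
        + 2 * + A₂₃₁ (suc m) + - + 0              ≡⟨ cong (_+ - + 0) (sym (cst⊛ (+ 2) D (suc m))) ⟩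
        (cst (+ 2) ⊛ D) (suc m) + - one (suc m)   ∎
        where open ≡-Reasoning
    equation : horner (+ 1 ∷ - (+ 2) ∷ []) ⊛ D ≗ horner (+ 1 ∷ - (+ 1) ∷ [])
    equation = ≗-by-residual {K = one}
      (solve 2 (λ D x → hornerₑ (+ 1 ∷ - (+ 2) ∷ []) x :* D
                     := hornerₑ (+ 1 ∷ - (+ 1) ∷ []) x :+ con (+ 1) :* (D :+ :- (con (+ 1) :+ x :* (con (+ 2) :* D :+ :- con (+ 1)))))
               R.refl D X)
      D-eq

  f123≡f321 : ∀ n → f (dashless 1 2 3) n ≡ f (dashless 3 2 1) n
  f123≡f321 n = trans (f≡count132 1 2 3 n) (trans (sym (A₃₂₁≗A₁₂₃ n)) (sym (f≡count132 3 2 1 n)))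

  f213≡f312 : ∀ n → f (dashless 2 1 3) n ≡ f (dashless 3 1 2) n
  f213≡f312 n = trans (f≡count132 2 1 3 n) (trans (sym (A₃₁₂≗A₂₁₃ n)) (sym (f≡count132 3 1 2 n)))

open import Defs using (f; F; dashless; poly; _⊛_; _⊖_)
open import Data.Integer using (+_; -_)
open import Data.List using ([]; _∷_)
open import Data.Product using (_×_; _,_; ∃-syntax)
open import Relation.Binary.PropositionalEquality using (_≡_)
open GeneratingFunctions

corollary2p19 :
    -- (1) F_123 = F_321 = (1 - x - √(1-2x-3x²)) / (2x²)
    ((∀ n → f (dashless 1 2 3) n ≡ f (dashless 3 2 1) n)
      × (∃[ G ] ((∀ n → (G ⊛ G) n ≡ poly (+ 1 ∷ - (+ 2) ∷ - (+ 3) ∷ []) n)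
          × G 0 ≡ + 1
          × (∀ n → (poly (+ 0 ∷ + 0 ∷ + 2 ∷ []) ⊛ F (dashless 1 2 3)) n
                   ≡ (poly (+ 1 ∷ - (+ 1) ∷ []) ⊖ G) n))))
    -- (2) F_132 = (1 - √(1-4x)) / (2x)
    × (∃[ G ] ((∀ n → (G ⊛ G) n ≡ poly (+ 1 ∷ - (+ 4) ∷ []) n)
          × G 0 ≡ + 1
          × (∀ n → (poly (+ 0 ∷ + 2 ∷ []) ⊛ F (dashless 1 3 2)) n
                   ≡ (poly (+ 1 ∷ []) ⊖ G) n)))
    -- (3) F_213 = F_312 = (1 - x² - √((1+x²)² - 4x)) / (2x(1-x))
    × ((∀ n → f (dashless 2 1 3) n ≡ f (dashless 3 1 2) n)
      × (∃[ G ] ((∀ n → (G ⊛ G) n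
                       ≡ poly (+ 1 ∷ - (+ 4) ∷ + 2 ∷ + 0 ∷ + 1 ∷ []) n)
          × G 0 ≡ + 1
          × (∀ n → (poly (+ 0 ∷ + 2 ∷ - (+ 2) ∷ []) ⊛ F (dashless 2 1 3)) n
                   ≡ (poly (+ 1 ∷ + 0 ∷ - (+ 1) ∷ []) ⊖ G) n))))
    -- (4) F_231 = (1 - x) / (1 - 2x)
    × (∀ n → (poly (+ 1 ∷ - (+ 2) ∷ []) ⊛ F (dashless 2 3 1)) n
             ≡ poly (+ 1 ∷ - (+ 1) ∷ []) n)
corollary2p19 = (f123≡f321 , closed-form-123) , closed-form-132 , (f213≡f312 , closed-form-213) , closed-form-231
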